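{- Let $G=(V,E)$ be a finite simple maximally connected graph with minimum degree $\delta(G)$ and $|V|\geq 2(\delta(G)-h)+3$. Suppose that either $\delta(G)\geq 3$ and $C(G)\leq \delta(G)-2$, or $\delta(G)\geq 4$ and $C(G)\leq \delta(G)-1$. Then for every integer $h$ with $0\leq h\leq \lfloor (\delta(G)-1)/2\rfloor$, the $h$-edge tolerable diagnosability of $G$ under the MM$^*$ model is $t_h^e(G)=\delta(G)-h$.
   Context: A graph $G$ is maximally connected if its minimum degree $\delta(G)$ equals its vertex connectivity $\kappa(G)$. $C(G)$ denotes the maximum number of common neighbors of two distinct vertices of $G$. For sets $A,B$, $A-B$ is set difference and $F_1\bigtriangleup F_2=(F_1-F_2)\cup(F_2-F_1)$. Under the MM$^*$ model, a graph $G=(V,E)$ is $t$-diagnosable if and only if for any two distinct subsets $F_1,F_2\subseteq V$ with $|F_1|\leq t$, $|F_2|\leq t$, at least one of the following holds: (1) there are $u,w\in V-(F_1\cup F_2)$ and $v\in F_1\bigtriangleup F_2$ with $uv,uw\in E$; (2) there are $u,v\in F_1-F_2$ and $w\in V-(F_1\cup F_2)$ with $uw,vw\in E$; (3) there are $u,v\in F_2-F_1$ and $w\in V-(F_1\cup F_2)$ with $uw,vw\in E$. A graph $G$ is $h$-edge tolerable $t$-diagnosable under the model if for every $F_e\subseteq E$ with $|F_e|\leq h$, $G-F_e$ is $t$-diagnosable under the model; $t_h^e(G)$ is the maximum such $t$. -}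

module Defs where

open import Data.Nat using (ℕ; _≤_; _<_)
open import Data.Bool using (Bool; true; false; _∧_; not)
open import Data.Fin using (Fin; toℕ)
open import Data.Fin.Subset using (Subset; _∈_; _∉_; _∪_; _∩_; _─_; ∣_∣; ⁅_⁆)
open import Data.Vec using (tabulate)
open import Data.List using (List; map; allFin)
open import Data.Nat.ListAction using (sum)
open import Data.Product using (Σ; _×_; ∃; ∃-syntax; _,_)
open import Data.Sum using (_⊎_)
open import Relation.Nullary using (¬_)
open import Relation.Nullary.Decidable using (⌊_⌋)
open import Relation.Binary.PropositionalEquality using (_≡_; _≢_)
open import Data.Nat.Properties using (_<?_)

record Graph (n : ℕ) : Set where
  field
    adj    : Fin n → Fin n → Bool
    sym    : ∀ i j → adj i j ≡ adj j i
    irrefl : ∀ i → adj i i ≡ false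
open Graph public

Edge : ∀ {n} → Graph n → Fin n → Fin n → Set
Edge G u v = adj G u v ≡ true

N : ∀ {n} → Graph n → Fin n → Subset n
N G v = tabulate (adj G v)

deg : ∀ {n} → Graph n → Fin n → ℕ
deg G v = ∣ N G v ∣

IsMinDegree : ∀ {n} → Graph n → ℕ → Set
IsMinDegree G d = (∃[ v ] deg G v ≡ d) × (∀ v → d ≤ deg G v)

data Reach {n} (G : Graph n) (S : Subset n) (u : Fin n) : Fin n → Set where
  here : u ∉ S → Reach G S u u
  step : ∀ {v w} → Reach G S u v → Edge G v w → w ∉ S → Reach G S u w

DisconnectedOrTrivial : ∀ {n} → Graph n → Subset n → Set
DisconnectedOrTrivial {n} G S =
  (∃[ u ] ∃[ v ] (u ∉ S × v ∉ S × ¬ Reach G S u v))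
  ⊎ (n ≤ ∣ S ∣ Data.Nat.+ 1)
  where import Data.Nat

IsVertexConnectivity : ∀ {n} → Graph n → ℕ → Set
IsVertexConnectivity G k =
  (∃[ S ] (∣ S ∣ ≡ k × DisconnectedOrTrivial G S))
  × (∀ S → DisconnectedOrTrivial G S → k ≤ ∣ S ∣)

MaximallyConnected : ∀ {n} → Graph n → Set
MaximallyConnected G = ∃[ d ] (IsMinDegree G d × IsVertexConnectivity G d)

IsMaxCommonNeighbours : ∀ {n} → Graph n → ℕ → Set
IsMaxCommonNeighbours G c =
  (∃[ u ] ∃[ v ] (u ≢ v × ∣ N G u ∩ N G v ∣ ≡ c))
  × (∀ u v → u ≢ v → ∣ N G u ∩ N G v ∣ ≤ c)

_△_ : ∀ {n} → Subset n → Subset n → Subset n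
F₁ △ F₂ = (F₁ ─ F₂) ∪ (F₂ ─ F₁)

Cond1 : ∀ {n} → Graph n → Subset n → Subset n → Set
Cond1 G F₁ F₂ = ∃[ u ] ∃[ w ] ∃[ v ]
  (u ∉ F₁ ∪ F₂ × w ∉ F₁ ∪ F₂ × v ∈ F₁ △ F₂ × Edge G u v × Edge G u w)

Cond23 : ∀ {n} → Graph n → Subset n → Subset n → Subset n → Set
Cond23 G A F₁ F₂ = ∃[ u ] ∃[ v ] ∃[ w ]
  (u ≢ v × u ∈ A × v ∈ A × w ∉ F₁ ∪ F₂ × Edge G u w × Edge G v w)

Diagnosable : ∀ {n} → Graph n → ℕ → Set
Diagnosable {n} G t = ∀ (F₁ F₂ : Subset n) → F₁ ≢ F₂ →
  ∣ F₁ ∣ ≤ t → ∣ F₂ ∣ ≤ t →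
  Cond1 G F₁ F₂ ⊎ Cond23 G (F₁ ─ F₂) F₁ F₂ ⊎ Cond23 G (F₂ ─ F₁) F₁ F₂

-- an edge set F_e ⊆ E(G), represented as a (symmetric, loopless) spanning
-- subgraph of G
IsSubgraph : ∀ {n} → Graph n → Graph n → Set
IsSubgraph F G = ∀ u v → Edge F u v → Edge G u v

edgeCount : ∀ {n} → Graph n → ℕ
edgeCount {n} F = sum (map (λ u → ∣ tabulate (λ v → ⌊ toℕ u <? toℕ v ⌋ ∧ adj F u v) ∣) (allFin n))

removeEdges : ∀ {n} → Graph n → Graph n → Graph n
removeEdges G F = record
  { adj    = λ u v → adj G u v ∧ not (adj F u v)
  ; sym    = λ u v → lemma (sym G u v) (sym F u v)
  ; irrefl = λ u → lemma0 (irrefl G u)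
  }
  where
  open import Relation.Binary.PropositionalEquality using (refl)
  lemma : ∀ {a b c d : Bool} → a ≡ b → c ≡ d → (a ∧ not c) ≡ (b ∧ not d)
  lemma refl refl = refl
  lemma0 : ∀ {a c : Bool} → a ≡ false → (a ∧ not c) ≡ false
  lemma0 refl = refl

EdgeTolerableDiagnosable : ∀ {n} → Graph n → ℕ → ℕ → Set
EdgeTolerableDiagnosable {n} G h t = ∀ (F : Graph n) → IsSubgraph F G →
  edgeCount F ≤ h → Diagnosable (removeEdges G F) t

IsEdgeTolerableDiagnosability : ∀ {n} → Graph n → ℕ → ℕ → Set
IsEdgeTolerableDiagnosability G h t =
  EdgeTolerableDiagnosable G h t × (∀ t' → EdgeTolerableDiagnosable G h t' → t' ≤ t)

-- Let |F| ≤ h faulty edges be removed and t = δ − h. Lower bound: if two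
-- distinct fault sets F₁, F₂ of size ≤ t violate all three conditions, put
-- S = F₁ ∩ F₂, D = A ∪ B with A = F₁ − F₂, B = F₂ − F₁, U = V − (F₁ ∪ F₂) and
-- s = |S| < t. Since κ(G) = δ, removing S and the faulty edges cannot
-- separate G, so every U-vertex has a neighbour in D; the conditions then
-- force U to be independent and every U-vertex to have at most one neighbour
-- in each of A and B, so δ ≤ s + 2 + (faulty edges at u). As n ≥ 2t + 3
-- gives |U| ≥ s + 3, the case δ ≥ s + 3 needs more than 2h faulty edge ends,
-- and the cases δ ≤ s + 2 (so h ≤ 1) each produce two vertices with too many
-- common neighbours. Upper bound: after removing h edges at a vertex v of
-- degree δ, the sets N(v) and N(v) ∪ {v} of sizes t and t + 1 cannot be
-- told apart.
module Submission where

open import Defs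
open import Data.Nat using (ℕ; _≤_; _∸_; _+_; _*_)
open import Data.Nat.DivMod using (_/_)
open import Data.Product using (_×_; ∃-syntax)
open import Data.Sum using (_⊎_)

open import Data.Nat using (zero; suc; z≤n; s≤s; s≤s⁻¹; _<_)
open import Data.Nat.Properties
open import Data.Nat.DivMod using (m/n*n≤m)
open import Data.Nat.Tactic.RingSolver using (solve-∀)
import Data.Nat.ListAction as List using (sum)
open import Algebra.Properties.Semiring.Sum +-*-semiring
  using (sum; sum-syntax; sum-cong-≗; ∑-distrib-+; ∑-comm; *-distribˡ-sum)
open import Data.Bool using (Bool; true; false; _∧_; _∨_; not)
import Data.Bool as Bool using (_≟_)
open import Data.Bool.Properties
  using ( ∧-identityʳ; ∧-zeroˡ; ∧-zeroʳ; ∨-identityʳ; ∨-zeroʳ; ∧-comm; ∨-comm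
        ; ∧-conicalˡ; ∧-conicalʳ; ∨-conicalˡ; ∨-conicalʳ; not-injective)
open import Data.Fin using (Fin; zero; suc; toℕ)
import Data.Fin as Fin
import Data.Fin.Properties as Fin
open import Data.Fin.Subset using (Subset; _∈_; _∉_; _∪_; _∩_; _─_; ∣_∣; ⁅_⁆)
open import Data.Fin.Subset.Properties using (x∈p∪q⁺; x∈p∪q⁻; _∈?_)
open import Data.Vec using ([]; _∷_; lookup; tabulate)
open import Data.Vec.Properties
  using (lookup∘tabulate; lookup-zipWith; lookup-replicate; []=⇒lookup; lookup⇒[]=)
import Data.List as List using (map; allFin; tabulate)
open import Data.Empty using (⊥; ⊥-elim)
open import Data.Product using (_,_; proj₁; proj₂; ∃; ∃₂)
open import Data.Sum using (inj₁; inj₂)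
open import Function using (id; _∘_; case_of_)
open import Relation.Nullary using (Dec; yes; no; does; ¬_)
open import Relation.Nullary.Decidable using (_×-dec_; ¬?; ⌊_⌋; dec-true; dec-false; isYes≗does)
open import Relation.Binary.Definitions using (tri<; tri≈; tri>)
open import Relation.Binary.PropositionalEquality as ≡
  using (_≡_; _≢_; ≢-sym; refl; trans; cong; cong₂; subst; module ≡-Reasoning)

∧-true : ∀ {a b} → a ≡ true → b ≡ true → a ∧ b ≡ true
∧-true refl refl = refl

positive : ℕ → Bool
positive zero    = false
positive (suc _) = true

positive⇒1≤ : ∀ {m} → positive m ≡ true → 1 ≤ m
positive⇒1≤ {suc m} _ = s≤s z≤n

1≤⇒positive : ∀ {m} → 1 ≤ m → positive m ≡ true
1≤⇒positive {suc m} _ = refl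

∨-true : ∀ a {b} → a ∨ b ≡ true → a ≡ true ⊎ b ≡ true
∨-true true  _ = inj₁ refl
∨-true false b = inj₂ b

not≡true⇒≡false : ∀ {a} → not a ≡ true → a ≡ false
not≡true⇒≡false {false} _ = refl

𝟙 : Bool → ℕ
𝟙 true  = 1
𝟙 false = 0

count : ∀ {n} → (Fin n → Bool) → ℕ
count {n} P = ∑[ i < n ] 𝟙 (P i)

infix 4 _⊆ᵇ_
_⊆ᵇ_ : ∀ {n} → (Fin n → Bool) → (Fin n → Bool) → Set
P ⊆ᵇ Q = ∀ i → P i ≡ true → Q i ≡ true

sum-mono-≤ : ∀ {n} {f g : Fin n → ℕ} → (∀ i → f i ≤ g i) → sum f ≤ sum g
sum-mono-≤ {zero}  f≤g = z≤n
sum-mono-≤ {suc n} f≤g = +-mono-≤ (f≤g zero) (sum-mono-≤ (f≤g ∘ suc))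

term≤sum : ∀ {n} (f : Fin n → ℕ) i → f i ≤ sum f
term≤sum f zero    = m≤m+n _ _
term≤sum f (suc i) = ≤-trans (term≤sum (f ∘ suc) i) (m≤n+m _ _)

∑-distrib-+₃ : ∀ {n} (f g h : Fin n → ℕ) →
  ∑[ i < n ] (f i + g i + h i) ≡ ∑[ i < n ] f i + ∑[ i < n ] g i + ∑[ i < n ] h i
∑-distrib-+₃ f g h = trans (∑-distrib-+ (λ i → f i + g i) h) (cong (_+ sum h) (∑-distrib-+ f g))

sum-zero : ∀ {n} → ∑[ i < n ] 0 ≡ 0
sum-zero {zero}  = refl
sum-zero {suc n} = sum-zero {n}

_==_ : ∀ {n} → Fin n → Fin n → Bool
i == j = does (i Fin.≟ j)

==-refl : ∀ {n} (i : Fin n) → i == i ≡ true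
==-refl i = dec-true (i Fin.≟ i) refl

≢⇒==-false : ∀ {n} {i j : Fin n} → i ≢ j → i == j ≡ false
≢⇒==-false {i = i} {j} = dec-false (i Fin.≟ j)

==⇒≡ : ∀ {n} {i j : Fin n} → i == j ≡ true → i ≡ j
==⇒≡ {i = i} {j} eq with i Fin.≟ j
... | yes i≡j = i≡j

∑-δ : ∀ {n} (v : Fin n) (k : ℕ) → ∑[ i < n ] (𝟙 (i == v) * k) ≡ k
∑-δ {suc n} zero    k = trans (cong₂ _+_ (+-identityʳ k) (sum-zero {n})) (+-identityʳ k)
∑-δ {suc n} (suc v) k = ∑-δ v k

count-cong : ∀ {n} {P Q : Fin n → Bool} → (∀ i → P i ≡ Q i) → count P ≡ count Q
count-cong P≗Q = sum-cong-≗ (cong 𝟙 ∘ P≗Q)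

𝟙-mono : ∀ {a b} → (a ≡ true → b ≡ true) → 𝟙 a ≤ 𝟙 b
𝟙-mono {false} a⇒b = z≤n
𝟙-mono {true}  a⇒b rewrite a⇒b refl = ≤-refl

count-mono : ∀ {n} {P Q : Fin n → Bool} → P ⊆ᵇ Q → count P ≤ count Q
count-mono P⊆Q = sum-mono-≤ (𝟙-mono ∘ P⊆Q)

count-true : ∀ {n} → count {n} (λ _ → true) ≡ n
count-true {zero}  = refl
count-true {suc n} = cong suc (count-true {n})

count-single : ∀ {n} (v : Fin n) → count (_== v) ≡ 1
count-single v = trans (sum-cong-≗ {y = λ i → 𝟙 (i == v) * 1} λ i → ≡.sym (*-identityʳ _)) (∑-δ v 1)

count-split : ∀ {n} (P Q : Fin n → Bool) →
  count P ≡ count (λ i → P i ∧ Q i) + count (λ i → P i ∧ not (Q i))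
count-split P Q =
  trans (sum-cong-≗ λ i → split (P i) (Q i)) (∑-distrib-+ (λ i → 𝟙 (P i ∧ Q i)) (λ i → 𝟙 (P i ∧ not (Q i))))
  where
  split : ∀ a b → 𝟙 a ≡ 𝟙 (a ∧ b) + 𝟙 (a ∧ not b)
  split false b     = refl
  split true  false = refl
  split true  true  = refl

count-∨ : ∀ {n} (P Q : Fin n → Bool) → count (λ i → P i ∨ Q i) ≤ count P + count Q
count-∨ P Q = ≤-trans (sum-mono-≤ λ i → 𝟙-∨ (P i) (Q i)) (≤-reflexive (∑-distrib-+ (𝟙 ∘ P) (𝟙 ∘ Q)))
  where
  𝟙-∨ : ∀ a b → 𝟙 (a ∨ b) ≤ 𝟙 a + 𝟙 b
  𝟙-∨ true  b = s≤s z≤n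
  𝟙-∨ false b = ≤-refl

count-∩-∪ : ∀ {n} {P Q Z : Fin n → Bool} → P ⊆ᵇ Z → Q ⊆ᵇ Z →
  count P + count Q ≤ count (λ i → P i ∧ Q i) + count Z
count-∩-∪ {P = P} {Q} {Z} P⊆Z Q⊆Z =
  ≤-trans (≤-reflexive (≡.sym (∑-distrib-+ (𝟙 ∘ P) (𝟙 ∘ Q))))
    (≤-trans (sum-mono-≤ pointwise) (≤-reflexive (∑-distrib-+ (λ i → 𝟙 (P i ∧ Q i)) (𝟙 ∘ Z))))
  where
  pointwise : ∀ i → 𝟙 (P i) + 𝟙 (Q i) ≤ 𝟙 (P i ∧ Q i) + 𝟙 (Z i)
  pointwise i with P i in p | Q i in q
  ... | false | false = z≤n
  ... | true  | true  rewrite P⊆Z i p = ≤-refl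
  ... | true  | false rewrite P⊆Z i p = ≤-refl
  ... | false | true  rewrite Q⊆Z i q = ≤-refl

∈⇒1≤count : ∀ {n} (P : Fin n → Bool) {i} → P i ≡ true → 1 ≤ count P
∈⇒1≤count P {i} Pi = ≤-trans (≤-reflexive (cong 𝟙 (≡.sym Pi))) (term≤sum (𝟙 ∘ P) i)

1≤count⇒∃ : ∀ {n} (P : Fin n → Bool) → 1 ≤ count P → ∃ λ i → P i ≡ true
1≤count⇒∃ {suc n} P 1≤c with P zero in P0
... | true  = zero , P0
... | false with 1≤count⇒∃ (P ∘ suc) 1≤c
...   | i , Pi = suc i , Pi

count≡0⇒false : ∀ {n} (P : Fin n → Bool) → count P ≡ 0 → ∀ i → P i ≡ false
count≡0⇒false P c≡0 i with P i in Pi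
... | false = refl
... | true  = ⊥-elim (1+n≰n (subst (1 ≤_) c≡0 (∈⇒1≤count P Pi)))

infixl 6 _without_
_without_ : ∀ {n} → (Fin n → Bool) → Fin n → Fin n → Bool
(P without v) i = P i ∧ not (i == v)

without-⊆ : ∀ {n} (P : Fin n → Bool) v → P without v ⊆ᵇ P
without-⊆ P v i Pi∧i≢v with P i
... | true = refl

without-≢ : ∀ {n} (P : Fin n → Bool) {v i} → (P without v) i ≡ true → i ≢ v
without-≢ P {v} Pv∧v≢v refl
  with trans (≡.sym (∧-zeroʳ (P v))) (subst (λ b → P v ∧ not b ≡ true) (==-refl v) Pv∧v≢v)
... | ()

∈-without : ∀ {n} (P : Fin n → Bool) {v i} → P i ≡ true → i ≢ v → (P without v) i ≡ true
∈-without P Pi i≢v rewrite Pi | ≢⇒==-false i≢v = refl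

count-remove : ∀ {n} (P : Fin n → Bool) {v} → P v ≡ true → count P ≡ 1 + count (P without v)
count-remove P {v} Pv =
  trans (count-split P (_== v)) (cong (_+ count (P without v)) (trans (count-cong on-v) (count-single v)))
  where
  on-v : ∀ i → P i ∧ (i == v) ≡ (i == v)
  on-v i with i Fin.≟ v
  ... | yes refl = trans (∧-identityʳ (P v)) Pv
  ... | no _     = ∧-zeroʳ (P i)

2≤count : ∀ {n} (P : Fin n → Bool) {i j} → i ≢ j → P i ≡ true → P j ≡ true → 2 ≤ count P
2≤count P i≢j Pi Pj =
  subst (2 ≤_) (≡.sym (count-remove P Pi)) (s≤s (∈⇒1≤count (P without _) (∈-without P Pj (≢-sym i≢j))))

3≤count : ∀ {n} (P : Fin n → Bool) {i j k} → i ≢ j → i ≢ k → j ≢ k →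
  P i ≡ true → P j ≡ true → P k ≡ true → 3 ≤ count P
3≤count P i≢j i≢k j≢k Pi Pj Pk =
  subst (3 ≤_) (≡.sym (count-remove P Pi))
    (s≤s (2≤count (P without _) j≢k (∈-without P Pj (≢-sym i≢j)) (∈-without P Pk (≢-sym i≢k))))

2≤count⇒∃ : ∀ {n} (P : Fin n → Bool) → 2 ≤ count P →
  ∃₂ λ i j → i ≢ j × P i ≡ true × P j ≡ true
2≤count⇒∃ P 2≤c with 1≤count⇒∃ P (≤-trans (s≤s z≤n) 2≤c)
... | i , Pi with 1≤count⇒∃ (P without i) (s≤s⁻¹ (subst (2 ≤_) (count-remove P Pi) 2≤c))
...   | j , Pj′ = i , j , ≢-sym (without-≢ P Pj′) , Pi , without-⊆ P i j Pj′

3≤count⇒∃ : ∀ {n} (P : Fin n → Bool) → 3 ≤ count P →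
  ∃₂ λ i j → ∃ λ k → i ≢ j × i ≢ k × j ≢ k × P i ≡ true × P j ≡ true × P k ≡ true
3≤count⇒∃ P 3≤c with 1≤count⇒∃ P (≤-trans (s≤s z≤n) 3≤c)
... | i , Pi with 2≤count⇒∃ (P without i) (s≤s⁻¹ (subst (3 ≤_) (count-remove P Pi) 3≤c))
...   | j , k , j≢k , Pj′ , Pk′ =
  i , j , k , ≢-sym (without-≢ P Pj′) , ≢-sym (without-≢ P Pk′) , j≢k ,
  Pi , without-⊆ P i j Pj′ , without-⊆ P i k Pk′

unique⇒count≤1 : ∀ {n} (P : Fin n → Bool) →
  (∀ i j → P i ≡ true → P j ≡ true → i ≡ j) → count P ≤ 1
unique⇒count≤1 P unique with 2 ≤? count P
... | no  2≰c = s≤s⁻¹ (≰⇒> 2≰c)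
... | yes 2≤c with 2≤count⇒∃ P 2≤c
...   | i , j , i≢j , Pi , Pj = ⊥-elim (i≢j (unique i j Pi Pj))

count≤2-pigeonhole : ∀ {n} (P : Fin n → Bool) → count P ≤ 2 → ∀ {i j k} →
  P i ≡ true → P j ≡ true → P k ≡ true → i ≡ j ⊎ i ≡ k ⊎ j ≡ k
count≤2-pigeonhole P c≤2 {i} {j} {k} Pi Pj Pk with i Fin.≟ j | i Fin.≟ k | j Fin.≟ k
... | yes i≡j | _ | _ = inj₁ i≡j
... | no _ | yes i≡k | _ = inj₂ (inj₁ i≡k)
... | no _ | no _ | yes j≡k = inj₂ (inj₂ j≡k)
... | no i≢j | no i≢k | no j≢k = ⊥-elim (1+n≰n (≤-trans (3≤count P i≢j i≢k j≢k Pi Pj Pk) c≤2))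

⊆-count≥⇒⊇ : ∀ {n} {P Q : Fin n → Bool} → P ⊆ᵇ Q → count Q ≤ count P → Q ⊆ᵇ P
⊆-count≥⇒⊇ {P = P} {Q} P⊆Q cQ≤cP i Qi with P i in Pi
... | true  = refl
... | false = ⊥-elim (<⇒≱ cP<cQ cQ≤cP)
  where
  open ≤-Reasoning
  Q∧P≗P : ∀ j → Q j ∧ P j ≡ P j
  Q∧P≗P j with P j in Pj
  ... | true  rewrite P⊆Q j Pj = refl
  ... | false = ∧-zeroʳ (Q j)
  cP<cQ : count P < count Q
  cP<cQ = begin-strict
    count P                                                          ≡⟨ count-cong Q∧P≗P ⟨
    count (λ j → Q j ∧ P j)
      <⟨ m<m+n _ (∈⇒1≤count (λ j → Q j ∧ not (P j)) (cong₂ _∧_ Qi (cong not Pi))) ⟩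
    count (λ j → Q j ∧ P j) + count (λ j → Q j ∧ not (P j))          ≡⟨ count-split Q P ⟨
    count Q                                                          ∎

true⇒∈ : ∀ {n} {p : Subset n} {x} → lookup p x ≡ true → x ∈ p
true⇒∈ {p = p} {x} = lookup⇒[]= x p

false⇒∉ : ∀ {n} {p : Subset n} {x} → lookup p x ≡ false → x ∉ p
false⇒∉ px≡false x∈p with trans (≡.sym ([]=⇒lookup x∈p)) px≡false
... | ()

∉⇒false : ∀ {n} {p : Subset n} {x} → x ∉ p → lookup p x ≡ false
∉⇒false {p = p} {x} x∉p with lookup p x in px
... | false = refl
... | true  = ⊥-elim (x∉p (true⇒∈ px))

lookup-∪ : ∀ {n} (p q : Subset n) x → lookup (p ∪ q) x ≡ lookup p x ∨ lookup q x
lookup-∪ p q x = lookup-zipWith _∨_ x p q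

lookup-∩ : ∀ {n} (p q : Subset n) x → lookup (p ∩ q) x ≡ lookup p x ∧ lookup q x
lookup-∩ p q x = lookup-zipWith _∧_ x p q

lookup-─ : ∀ {n} (p q : Subset n) x → lookup (p ─ q) x ≡ lookup p x ∧ not (lookup q x)
lookup-─ (a ∷ p) (true  ∷ q) zero    = ≡.sym (∧-zeroʳ a)
lookup-─ (a ∷ p) (false ∷ q) zero    = ≡.sym (∧-identityʳ a)
lookup-─ (a ∷ p) (b     ∷ q) (suc x) = lookup-─ p q x

lookup-⁅⁆ : ∀ {n} (v x : Fin n) → lookup ⁅ v ⁆ x ≡ x == v
lookup-⁅⁆ zero    zero    = refl
lookup-⁅⁆ zero    (suc x) = lookup-replicate x false
lookup-⁅⁆ (suc v) zero    = refl
lookup-⁅⁆ (suc v) (suc x) = lookup-⁅⁆ v x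

∣p∣≡count : ∀ {n} (p : Subset n) → ∣ p ∣ ≡ count (lookup p)
∣p∣≡count []          = refl
∣p∣≡count (true  ∷ p) = cong suc (∣p∣≡count p)
∣p∣≡count (false ∷ p) = ∣p∣≡count p

∣tabulate∣≡count : ∀ {n} (P : Fin n → Bool) → ∣ tabulate P ∣ ≡ count P
∣tabulate∣≡count P = trans (∣p∣≡count (tabulate P)) (count-cong (lookup∘tabulate P))

≢⇒∃lookup≢ : ∀ {n} (p q : Subset n) → p ≢ q → ∃ λ i → lookup p i ≢ lookup q i
≢⇒∃lookup≢ []      []      []≢[] = ⊥-elim ([]≢[] refl)
≢⇒∃lookup≢ (a ∷ p) (b ∷ q) p≢q with a Bool.≟ b
... | no  a≢b  = zero , a≢b
... | yes refl with ≢⇒∃lookup≢ p q (p≢q ∘ cong (a ∷_))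
...   | i , pi≢qi = suc i , pi≢qi

Edge-sym : ∀ {n} (G : Graph n) {x z} → Edge G x z → Edge G z x
Edge-sym G {x} {z} xz = trans (sym G z x) xz

Edge⇒≢ : ∀ {n} (G : Graph n) {x z} → Edge G x z → x ≢ z
Edge⇒≢ G {x} Gxx refl with trans (≡.sym Gxx) (irrefl G x)
... | ()

reachEnd : ∀ {n} {G : Graph n} {S u v} → Reach G S u v → v ∉ S
reachEnd (here u∉S)     = u∉S
reachEnd (step _ _ v∉S) = v∉S

deg≡count : ∀ {n} (G : Graph n) v → deg G v ≡ count (adj G v)
deg≡count G v = ∣tabulate∣≡count (adj G v)

lookup-N : ∀ {n} (G : Graph n) v x → lookup (N G v) x ≡ adj G v x
lookup-N G v x = lookup∘tabulate (adj G v) x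

∣N∩N∣≡count : ∀ {n} (G : Graph n) u v → ∣ N G u ∩ N G v ∣ ≡ count (λ x → adj G u x ∧ adj G v x)
∣N∩N∣≡count G u v = trans (∣p∣≡count (N G u ∩ N G v))
  (count-cong λ x → trans (lookup-∩ (N G u) (N G v) x) (cong₂ _∧_ (lookup-N G u x) (lookup-N G v x)))

deg≤deg-removeEdges+faults : ∀ {n} (G F : Graph n) u →
  deg G u ≤ count (adj (removeEdges G F) u) + count (adj F u)
deg≤deg-removeEdges+faults G F u = begin
  deg G u                                                 ≡⟨ deg≡count G u ⟩
  count (adj G u)                                         ≤⟨ sum-mono-≤ (λ x → split (adj G u x) (adj F u x)) ⟩
  ∑[ x < _ ] (𝟙 (adj G u x ∧ not (adj F u x)) + 𝟙 (adj F u x))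
    ≡⟨ ∑-distrib-+ (λ x → 𝟙 (adj G u x ∧ not (adj F u x))) (𝟙 ∘ adj F u) ⟩
  count (adj (removeEdges G F) u) + count (adj F u)       ∎
  where
  open ≤-Reasoning
  split : ∀ a b → 𝟙 a ≤ 𝟙 (a ∧ not b) + 𝟙 b
  split false b     = z≤n
  split true  false = ≤-refl
  split true  true  = ≤-refl

neighbourhoods-not-within : ∀ {n} (G : Graph n) {δ c u₁ u₂} (Z : Fin n → Bool) →
  δ ≤ deg G u₁ → δ ≤ deg G u₂ → count (λ x → adj G u₁ x ∧ adj G u₂ x) ≤ c → c < δ →
  adj G u₁ ⊆ᵇ Z → adj G u₂ ⊆ᵇ Z → count Z ≤ δ → ⊥
neighbourhoods-not-within G {δ} {c} {u₁} {u₂} Z δ≤d₁ δ≤d₂ common≤c c<δ N₁⊆Z N₂⊆Z ∣Z∣≤δ =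
  <⇒≱ (+-monoˡ-< δ c<δ) (begin
    δ + δ                                                 ≤⟨ +-mono-≤ δ≤d₁ δ≤d₂ ⟩
    deg G u₁ + deg G u₂                                   ≡⟨ cong₂ _+_ (deg≡count G u₁) (deg≡count G u₂) ⟩
    count (adj G u₁) + count (adj G u₂)                   ≤⟨ count-∩-∪ N₁⊆Z N₂⊆Z ⟩
    count (λ x → adj G u₁ x ∧ adj G u₂ x) + count Z       ≤⟨ +-mono-≤ common≤c ∣Z∣≤δ ⟩
    c + δ                                                 ∎)
  where open ≤-Reasoning

-- Double counting of edges

_<ᵇ_ : ∀ {n} → Fin n → Fin n → Bool
u <ᵇ v = ⌊ toℕ u <? toℕ v ⌋

<⇒<ᵇ≡true : ∀ {n} {u v : Fin n} → u Fin.< v → u <ᵇ v ≡ true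
<⇒<ᵇ≡true {u = u} {v} u<v = trans (isYes≗does (toℕ u <? toℕ v)) (dec-true (toℕ u <? toℕ v) u<v)

≮⇒<ᵇ≡false : ∀ {n} {u v : Fin n} → ¬ u Fin.< v → u <ᵇ v ≡ false
≮⇒<ᵇ≡false {u = u} {v} u≮v = trans (isYes≗does (toℕ u <? toℕ v)) (dec-false (toℕ u <? toℕ v) u≮v)

𝟙-∧ : ∀ a b → 𝟙 (a ∧ b) ≡ 𝟙 a * 𝟙 b
𝟙-∧ true  b = ≡.sym (+-identityʳ (𝟙 b))
𝟙-∧ false b = refl

sum-allFin : ∀ {n} (f : Fin n → ℕ) → List.sum (List.map f (List.allFin n)) ≡ sum f
sum-allFin {n} f = go id
  where
  go : ∀ {m} (g : Fin m → Fin n) → List.sum (List.map f (List.tabulate g)) ≡ ∑[ i < m ] f (g i)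
  go {zero}  g = refl
  go {suc m} g = cong (f (g zero) +_) (go (g ∘ suc))

edgeCount≡∑∑ : ∀ {n} (F : Graph n) →
  edgeCount F ≡ ∑[ u < n ] ∑[ v < n ] (𝟙 (u <ᵇ v) * 𝟙 (adj F u v))
edgeCount≡∑∑ {n} F = trans (sum-allFin (λ u → ∣ tabulate (λ v → u <ᵇ v ∧ adj F u v) ∣))
  (sum-cong-≗ λ u →
    trans (∣tabulate∣≡count (λ v → u <ᵇ v ∧ adj F u v)) (sum-cong-≗ λ v → 𝟙-∧ (u <ᵇ v) (adj F u v)))

-- Every off-diagonal pair {u, v} is counted once with u < v and once with v < u.
∑∑-offDiagonal : ∀ {n} (w : Fin n → Fin n → ℕ) → (∀ u → w u u ≡ 0) →
  ∑[ u < n ] ∑[ v < n ] w u v ≡ ∑[ u < n ] ∑[ v < n ] (𝟙 (u <ᵇ v) * (w u v + w v u))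
∑∑-offDiagonal {n} w w-diag = begin
  ∑[ u < n ] ∑[ v < n ] w u v
    ≡⟨ sum-cong-≗ (λ u → sum-cong-≗ λ v → ordered u v) ⟩
  ∑[ u < n ] ∑[ v < n ] (𝟙 (u <ᵇ v) * w u v + 𝟙 (v <ᵇ u) * w u v)
    ≡⟨ sum-cong-≗ (λ u → ∑-distrib-+ (λ v → 𝟙 (u <ᵇ v) * w u v) (λ v → 𝟙 (v <ᵇ u) * w u v)) ⟩
  ∑[ u < n ] (∑[ v < n ] (𝟙 (u <ᵇ v) * w u v) + ∑[ v < n ] (𝟙 (v <ᵇ u) * w u v))
    ≡⟨ ∑-distrib-+ (λ u → ∑[ v < n ] (𝟙 (u <ᵇ v) * w u v)) (λ u → ∑[ v < n ] (𝟙 (v <ᵇ u) * w u v)) ⟩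
  ∑[ u < n ] ∑[ v < n ] (𝟙 (u <ᵇ v) * w u v) + ∑[ u < n ] ∑[ v < n ] (𝟙 (v <ᵇ u) * w u v)
    ≡⟨ cong (∑[ u < n ] ∑[ v < n ] (𝟙 (u <ᵇ v) * w u v) +_) (∑-comm (λ u v → 𝟙 (v <ᵇ u) * w u v)) ⟩
  ∑[ u < n ] ∑[ v < n ] (𝟙 (u <ᵇ v) * w u v) + ∑[ u < n ] ∑[ v < n ] (𝟙 (u <ᵇ v) * w v u)
    ≡⟨ ∑-distrib-+ (λ u → ∑[ v < n ] (𝟙 (u <ᵇ v) * w u v)) (λ u → ∑[ v < n ] (𝟙 (u <ᵇ v) * w v u)) ⟨
  ∑[ u < n ] (∑[ v < n ] (𝟙 (u <ᵇ v) * w u v) + ∑[ v < n ] (𝟙 (u <ᵇ v) * w v u))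
    ≡⟨ sum-cong-≗ (λ u → ∑-distrib-+ (λ v → 𝟙 (u <ᵇ v) * w u v) (λ v → 𝟙 (u <ᵇ v) * w v u)) ⟨
  ∑[ u < n ] ∑[ v < n ] (𝟙 (u <ᵇ v) * w u v + 𝟙 (u <ᵇ v) * w v u)
    ≡⟨ sum-cong-≗ (λ u → sum-cong-≗ λ v → *-distribˡ-+ (𝟙 (u <ᵇ v)) (w u v) (w v u)) ⟨
  ∑[ u < n ] ∑[ v < n ] (𝟙 (u <ᵇ v) * (w u v + w v u))
    ∎
  where
  open ≡-Reasoning
  ordered : ∀ u v → w u v ≡ 𝟙 (u <ᵇ v) * w u v + 𝟙 (v <ᵇ u) * w u v
  ordered u v with Fin.<-cmp u v
  ... | tri< u<v _ v≮u rewrite <⇒<ᵇ≡true u<v | ≮⇒<ᵇ≡false v≮u =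
    ≡.sym (trans (+-identityʳ _) (+-identityʳ _))
  ... | tri≈ _ refl _ rewrite w-diag u = ≡.sym (cong₂ _+_ (*-zeroʳ (𝟙 (u <ᵇ u))) (*-zeroʳ (𝟙 (u <ᵇ u))))
  ... | tri> u≮v _ v<u rewrite ≮⇒<ᵇ≡false u≮v | <⇒<ᵇ≡true v<u = ≡.sym (+-identityʳ _)

∑deg≡2*edgeCount : ∀ {n} (F : Graph n) → ∑[ u < n ] count (adj F u) ≡ 2 * edgeCount F
∑deg≡2*edgeCount {n} F = begin
  ∑[ u < n ] ∑[ v < n ] a u v
    ≡⟨ ∑∑-offDiagonal a (λ u → cong 𝟙 (irrefl F u)) ⟩
  ∑[ u < n ] ∑[ v < n ] (𝟙 (u <ᵇ v) * (a u v + a v u))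
    ≡⟨ sum-cong-≗ (λ u → sum-cong-≗ λ v → doubled u v) ⟩
  ∑[ u < n ] ∑[ v < n ] (2 * (𝟙 (u <ᵇ v) * a u v))
    ≡⟨ sum-cong-≗ (λ u → *-distribˡ-sum 2 (λ v → 𝟙 (u <ᵇ v) * a u v)) ⟨
  ∑[ u < n ] (2 * ∑[ v < n ] (𝟙 (u <ᵇ v) * a u v))
    ≡⟨ *-distribˡ-sum 2 (λ u → ∑[ v < n ] (𝟙 (u <ᵇ v) * a u v)) ⟨
  2 * ∑[ u < n ] ∑[ v < n ] (𝟙 (u <ᵇ v) * a u v)
    ≡⟨ cong (2 *_) (edgeCount≡∑∑ F) ⟨
  2 * edgeCount F
    ∎
  where
  open ≡-Reasoning
  a : Fin n → Fin n → ℕ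
  a u v = 𝟙 (adj F u v)
  doubled : ∀ u v → 𝟙 (u <ᵇ v) * (a u v + a v u) ≡ 2 * (𝟙 (u <ᵇ v) * a u v)
  doubled u v rewrite sym F v u = x*[y+y]≡2*[x*y] (𝟙 (u <ᵇ v)) (a u v)
    where
    x*[y+y]≡2*[x*y] : ∀ x y → x * (y + y) ≡ 2 * (x * y)
    x*[y+y]≡2*[x*y] = solve-∀

𝟙*count : ∀ {n} a (Q : Fin n → Bool) → 𝟙 a * count Q ≡ count (λ i → a ∧ Q i)
𝟙*count true  Q = +-identityʳ (count Q)
𝟙*count {n} false Q = ≡.sym (sum-zero {n})

edgesBetween≤edgeCount : ∀ {n} (F : Graph n) (X Y : Fin n → Bool) → (∀ x → X x ≡ true → Y x ≡ false) →
  ∑[ x < n ] (𝟙 (X x) * count (λ y → adj F x y ∧ Y y)) ≤ edgeCount F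
edgesBetween≤edgeCount {n} F X Y X⇒¬Y = begin
  ∑[ x < n ] (𝟙 (X x) * count (λ y → adj F x y ∧ Y y))
    ≡⟨ sum-cong-≗ (λ x → 𝟙*count (X x) (λ y → adj F x y ∧ Y y)) ⟩
  ∑[ x < n ] ∑[ y < n ] w x y
    ≡⟨ ∑∑-offDiagonal w w-diag ⟩
  ∑[ x < n ] ∑[ y < n ] (𝟙 (x <ᵇ y) * (w x y + w y x))
    ≤⟨ sum-mono-≤ (λ x → sum-mono-≤ λ y → *-monoʳ-≤ (𝟙 (x <ᵇ y)) (between x y)) ⟩
  ∑[ x < n ] ∑[ y < n ] (𝟙 (x <ᵇ y) * 𝟙 (adj F x y))
    ≡⟨ edgeCount≡∑∑ F ⟨
  edgeCount F
    ∎
  where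
  open ≤-Reasoning
  w : Fin n → Fin n → ℕ
  w x y = 𝟙 (X x ∧ (adj F x y ∧ Y y))
  w-diag : ∀ x → w x x ≡ 0
  w-diag x rewrite irrefl F x = cong 𝟙 (∧-zeroʳ (X x))
  between : ∀ x y → w x y + w y x ≤ 𝟙 (adj F x y)
  between x y rewrite sym F y x with X x in Xx | X y in Xy
  ... | false | false = z≤n
  ... | true  | false = ≤-trans (≤-reflexive (+-identityʳ _)) (𝟙-mono (∧-conicalˡ (adj F x y) (Y y)))
  ... | false | true  = 𝟙-mono (∧-conicalˡ (adj F x y) (Y x))
  ... | true  | true  rewrite X⇒¬Y x Xx | X⇒¬Y y Xy | ∧-zeroʳ (adj F x y) = z≤n

-- Separating a graph with few faulty edges

-- If G − F has no edge between a nonempty X and the nonempty rest Y of V − T,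
-- then either some vertex of X sends no F-edge into Y, and T together with
-- the X-ends of these edges separates G, or every vertex of X does, and a
-- vertex of X has at most |T| + |F| neighbours.
module Separation {n} (G F : Graph n) (δ : ℕ)
  (δ≤deg : ∀ v → δ ≤ deg G v)
  (δ≤κ : ∀ S → DisconnectedOrTrivial G S → δ ≤ ∣ S ∣)
  (T X : Fin n → Bool)
  where

  Y : Fin n → Bool
  Y z = not (T z ∨ X z)

  module _ (X∩T≡∅ : ∀ z → X z ≡ true → T z ≡ false)
           (noEdge : ∀ x y → X x ≡ true → Y y ≡ true → ¬ Edge (removeEdges G F) x y)
           {x₀ y₀ : Fin n} (Xx₀ : X x₀ ≡ true) (Yy₀ : Y y₀ ≡ true) where

    cut : Fin n → ℕ
    cut x = count (λ y → adj F x y ∧ Y y)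

    ∑cut : ℕ
    ∑cut = ∑[ x < n ] (𝟙 (X x) * cut x)

    X⇒¬Y : ∀ z → X z ≡ true → Y z ≡ false
    X⇒¬Y z Xz rewrite Xz = cong not (∨-zeroʳ (T z))

    Y⇒¬X : ∀ z → Y z ≡ true → X z ≡ false
    Y⇒¬X z Yz = ∨-conicalʳ (T z) (X z) (not≡true⇒≡false Yz)

    inCutSet : Fin n → Bool
    inCutSet v = T v ∨ (X v ∧ positive (cut v))

    cutSet : Subset n
    cutSet = tabulate inCutSet

    ∣cutSet∣≤T+∑cut : ∣ cutSet ∣ ≤ count T + ∑cut
    ∣cutSet∣≤T+∑cut = begin
      ∣ cutSet ∣                                         ≡⟨ ∣tabulate∣≡count inCutSet ⟩
      count inCutSet                                     ≤⟨ count-∨ T (λ v → X v ∧ positive (cut v)) ⟩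
      count T + count (λ v → X v ∧ positive (cut v))
        ≤⟨ +-monoʳ-≤ (count T) (sum-mono-≤ λ v → 𝟙-∧-pos (X v) (cut v)) ⟩
      count T + ∑cut                                     ∎
      where
      open ≤-Reasoning
      𝟙-∧-pos : ∀ a c → 𝟙 (a ∧ positive c) ≤ 𝟙 a * c
      𝟙-∧-pos false c       = z≤n
      𝟙-∧-pos true  zero    = z≤n
      𝟙-∧-pos true  (suc c) = s≤s z≤n

    ∉cutSet : ∀ {v} → v ∉ cutSet → T v ≡ false × (X v ≡ true → cut v ≡ 0)
    ∉cutSet {v} v∉ = ∨-conicalˡ (T v) _ out , cut≡0
      where
      out : inCutSet v ≡ false
      out = trans (≡.sym (lookup∘tabulate inCutSet v)) (∉⇒false v∉)
      cut≡0 : X v ≡ true → cut v ≡ 0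
      cut≡0 Xv with cut v | trans (≡.sym (cong (_∧ positive (cut v)) Xv)) (∨-conicalʳ (T v) _ out)
      ... | zero | _ = refl

    ∉cutSet∪X⇒Y : ∀ {z} → z ∉ cutSet → X z ≡ false → Y z ≡ true
    ∉cutSet∪X⇒Y z∉ Xz rewrite proj₁ (∉cutSet z∉) | Xz = refl

    edge-leaving-X : ∀ {v z} → X v ≡ true → v ∉ cutSet → Edge G v z → z ∉ cutSet → X z ≡ false → ⊥
    edge-leaving-X {v} {z} Xv v∉ Gvz z∉ Xz with adj F v z in Fvz
    ... | true  = 1+n≰n (subst (1 ≤_) (proj₂ (∉cutSet v∉) Xv)
                          (∈⇒1≤count (λ y → adj F v y ∧ Y y) (∧-true Fvz (∉cutSet∪X⇒Y z∉ Xz))))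
    ... | false = noEdge v z Xv (∉cutSet∪X⇒Y z∉ Xz) (∧-true Gvz (cong not Fvz))

    reach-within-X : ∀ {x z} → X x ≡ true → Reach G cutSet x z → X z ≡ true
    reach-within-X Xx (here _) = Xx
    reach-within-X Xx (step {w = z} path Gvz z∉) with X z in Xz
    ... | true  = refl
    ... | false = ⊥-elim (edge-leaving-X (reach-within-X Xx path) (reachEnd path) Gvz z∉ Xz)

    deg≤T+∑cut : (∀ x → X x ≡ true → 1 ≤ cut x) → deg G x₀ ≤ count T + ∑cut
    deg≤T+∑cut 1≤cut = begin
      deg G x₀                                                   ≡⟨ deg≡count G x₀ ⟩
      count (adj G x₀)                                           ≤⟨ sum-mono-≤ neighbour ⟩
      ∑[ z < n ] (𝟙 (T z) + 𝟙 ((X without x₀) z) + 𝟙 (adj F x₀ z ∧ Y z))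
        ≡⟨ ∑-distrib-+₃ (𝟙 ∘ T) (𝟙 ∘ (X without x₀)) (λ z → 𝟙 (adj F x₀ z ∧ Y z)) ⟩
      count T + count (X without x₀) + cut x₀                      ≡⟨ +-assoc (count T) _ _ ⟩
      count T + (count (X without x₀) + cut x₀)                    ≤⟨ +-monoʳ-≤ (count T) others ⟩
      count T + ∑cut                                             ∎
      where
      open ≤-Reasoning
      neighbour : ∀ z → 𝟙 (adj G x₀ z) ≤ 𝟙 (T z) + 𝟙 ((X without x₀) z) + 𝟙 (adj F x₀ z ∧ Y z)
      neighbour z with adj G x₀ z in Gx₀z | T z in Tz | X z in Xz
      ... | false | _     | _    = z≤n
      ... | true  | true  | _    = s≤s z≤n
      ... | true  | false | true rewrite ≢⇒==-false (≢-sym (Edge⇒≢ G Gx₀z)) = s≤s z≤n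
      ... | true  | false | false with adj F x₀ z in Fx₀z
      ...   | true  = ≤-refl
      ...   | false = ⊥-elim (noEdge x₀ z Xx₀ Yz (∧-true Gx₀z (cong not Fx₀z)))
        where
        Yz : Y z ≡ true
        Yz rewrite Tz | Xz = refl
      others : count (X without x₀) + cut x₀ ≤ ∑cut
      others = begin
        count (X without x₀) + cut x₀
          ≡⟨ cong (count (X without x₀) +_) (∑-δ x₀ (cut x₀)) ⟨
        count (X without x₀) + ∑[ x < n ] (𝟙 (x == x₀) * cut x₀)
          ≡⟨ ∑-distrib-+ (𝟙 ∘ (X without x₀)) (λ x → 𝟙 (x == x₀) * cut x₀) ⟨
        ∑[ x < n ] (𝟙 ((X without x₀) x) + 𝟙 (x == x₀) * cut x₀)
          ≤⟨ sum-mono-≤ pointwise ⟩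
        ∑cut
          ∎
        where
        pointwise : ∀ x → 𝟙 ((X without x₀) x) + 𝟙 (x == x₀) * cut x₀ ≤ 𝟙 (X x) * cut x
        pointwise x with x Fin.≟ x₀
        ... | yes refl rewrite Xx₀ = ≤-refl
        ... | no _ with X x in Xx
        ...   | false = z≤n
        ...   | true  = ≤-trans (≤-reflexive (+-identityʳ 1)) (≤-trans (1≤cut x Xx) (≤-reflexive (≡.sym (*-identityˡ _))))

    δ≤T+edgeCount : δ ≤ count T + edgeCount F
    δ≤T+edgeCount = ≤-trans δ≤T+∑cut (+-monoʳ-≤ (count T) (edgesBetween≤edgeCount F X Y X⇒¬Y))
      where
      δ≤T+∑cut : δ ≤ count T + ∑cut
      δ≤T+∑cut with Fin.any? (λ x → X x Bool.≟ true ×-dec cut x ≟ 0)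
      ... | yes (x₁ , Xx₁ , cut≡0) =
        ≤-trans (δ≤κ cutSet (inj₁ (x₁ , y₀ , x₁∉ , y₀∉ , ¬path))) ∣cutSet∣≤T+∑cut
        where
        x₁∉ : x₁ ∉ cutSet
        x₁∉ = false⇒∉ (trans (lookup∘tabulate inCutSet x₁) out)
          where
          out : inCutSet x₁ ≡ false
          out rewrite X∩T≡∅ x₁ Xx₁ | Xx₁ | cut≡0 = refl
        y₀∉ : y₀ ∉ cutSet
        y₀∉ = false⇒∉ (trans (lookup∘tabulate inCutSet y₀) out)
          where
          out : inCutSet y₀ ≡ false
          out rewrite ∨-conicalˡ (T y₀) (X y₀) (not≡true⇒≡false Yy₀) | Y⇒¬X y₀ Yy₀ = refl
        ¬path : ¬ Reach G cutSet x₁ y₀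
        ¬path path with trans (≡.sym (reach-within-X Xx₁ path)) (Y⇒¬X y₀ Yy₀)
        ... | ()
      ... | no ∄ = ≤-trans (δ≤deg x₀) (deg≤T+∑cut λ x Xx → n≢0⇒n>0 λ cut≡0 → ∄ (x , Xx , cut≡0))

-- The lower bound δ − h ≤ t_h^e(G)

δ≤s+2-cases : ∀ {s t} h → s < t → t + h ≤ s + 2 →
  (h ≡ 1 × t ≡ s + 1) ⊎ (h ≡ 0 × t ≡ s + 1) ⊎ (h ≡ 0 × t ≡ s + 2)
δ≤s+2-cases {s} {t} zero s<t t+0≤s+2 with t ≟ s + 1
... | yes t≡s+1 = inj₂ (inj₁ (refl , t≡s+1))
... | no  t≢s+1 = inj₂ (inj₂ (refl , ≤-antisym (≤-trans (≤-reflexive (≡.sym (+-identityʳ t))) t+0≤s+2) s+2≤t))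
  where
  s+2≤t : s + 2 ≤ t
  s+2≤t = ≤-trans (≤-reflexive (+-comm s 2)) (≤∧≢⇒< s<t λ 1+s≡t → t≢s+1 (trans (≡.sym 1+s≡t) (+-comm 1 s)))
δ≤s+2-cases {s} {t} 1 s<t t+1≤s+2 = inj₁ (refl , ≤-antisym t≤s+1 (≤-trans (≤-reflexive (+-comm s 1)) s<t))
  where
  t≤s+1 : t ≤ s + 1
  t≤s+1 = +-cancelʳ-≤ 1 t (s + 1) (≤-trans t+1≤s+2 (≤-reflexive (≡.sym (+-assoc s 1 1))))
δ≤s+2-cases {s} {t} (suc (suc h)) s<t t+h+2≤s+2 = ⊥-elim (<⇒≱ s<t (+-cancelʳ-≤ 2 t s (begin
  t + 2                ≤⟨ +-monoʳ-≤ t (m≤n+m 2 h) ⟩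
  t + (h + 2)          ≡⟨ cong (t +_) (+-comm h 2) ⟩
  t + suc (suc h)      ≤⟨ t+h+2≤s+2 ⟩
  s + 2                ∎)))
  where open ≤-Reasoning

module IndistinguishablePair {n} (G F : Graph n) (t h c : ℕ)
  (δ≤deg : ∀ v → t + h ≤ deg G v)
  (δ≤κ : ∀ S → DisconnectedOrTrivial G S → t + h ≤ ∣ S ∣)
  (3≤δ : 3 ≤ t + h) (c<δ : c < t + h) (δ≡3⇒c≤1 : t + h ≡ 3 → c ≤ 1)
  (C≤c : ∀ u v → u ≢ v → ∣ N G u ∩ N G v ∣ ≤ c)
  (h<t : h < t) (2t+3≤n : 2 * t + 3 ≤ n) (∣F∣≤h : edgeCount F ≤ h)
  (F₁ F₂ : Subset n) (F₁≢F₂ : F₁ ≢ F₂) (∣F₁∣≤t : ∣ F₁ ∣ ≤ t) (∣F₂∣≤t : ∣ F₂ ∣ ≤ t)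
  (¬cond₁ : ¬ Cond1 (removeEdges G F) F₁ F₂)
  (¬cond₂ : ¬ Cond23 (removeEdges G F) (F₁ ─ F₂) F₁ F₂)
  (¬cond₃ : ¬ Cond23 (removeEdges G F) (F₂ ─ F₁) F₁ F₂)
  where

  G′ : Graph n
  G′ = removeEdges G F

  inF₁ inF₂ inZ inS inA inB inD inU : Fin n → Bool
  inF₁ = lookup F₁
  inF₂ = lookup F₂
  inZ x = inF₁ x ∨ inF₂ x
  inS x = inF₁ x ∧ inF₂ x
  inA x = inF₁ x ∧ not (inF₂ x)
  inB x = inF₂ x ∧ not (inF₁ x)
  inD x = inA x ∨ inB x
  inU x = not (inZ x)

  s α β μ : ℕ
  s = count inS
  α = count inA
  β = count inB
  μ = count inU

  faults : Fin n → ℕ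
  faults u = count (adj F u)

  ∣F₁∣≡s+α : ∣ F₁ ∣ ≡ s + α
  ∣F₁∣≡s+α = trans (∣p∣≡count F₁) (count-split inF₁ inF₂)

  ∣F₂∣≡s+β : ∣ F₂ ∣ ≡ s + β
  ∣F₂∣≡s+β = trans (∣p∣≡count F₂)
    (trans (count-split inF₂ inF₁) (cong (_+ β) (count-cong λ x → ∧-comm (inF₂ x) (inF₁ x))))

  ∣Z∣≡s+α+β : count inZ ≡ s + α + β
  ∣Z∣≡s+α+β = trans (count-split inZ inF₁)
    (cong₂ _+_ (trans (count-cong Z∧F₁≗F₁) (count-split inF₁ inF₂)) (count-cong Z∧¬F₁≗B))
    where
    Z∧F₁≗F₁ : ∀ x → inZ x ∧ inF₁ x ≡ inF₁ x
    Z∧F₁≗F₁ x with inF₁ x | inF₂ x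
    ... | true  | _ = refl
    ... | false | _ = ∧-zeroʳ _
    Z∧¬F₁≗B : ∀ x → inZ x ∧ not (inF₁ x) ≡ inB x
    Z∧¬F₁≗B x with inF₁ x | inF₂ x
    ... | true  | b = ≡.sym (∧-zeroʳ b)
    ... | false | b = refl

  n≡∣Z∣+μ : n ≡ count inZ + μ
  n≡∣Z∣+μ = trans (≡.sym count-true) (count-split (λ _ → true) inZ)

  s+α≤t : s + α ≤ t
  s+α≤t = ≤-trans (≤-reflexive (≡.sym ∣F₁∣≡s+α)) ∣F₁∣≤t

  s+β≤t : s + β ≤ t
  s+β≤t = ≤-trans (≤-reflexive (≡.sym ∣F₂∣≡s+β)) ∣F₂∣≤t

  D-nonempty : ∃ λ x → inD x ≡ true
  D-nonempty with ≢⇒∃lookup≢ F₁ F₂ F₁≢F₂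
  ... | x , F₁x≢F₂x = x , differ (inF₁ x) (inF₂ x) F₁x≢F₂x
    where
    differ : ∀ a b → a ≢ b → (a ∧ not b) ∨ (b ∧ not a) ≡ true
    differ true  true  a≢b = ⊥-elim (a≢b refl)
    differ true  false _   = refl
    differ false true  _   = refl
    differ false false a≢b = ⊥-elim (a≢b refl)

  s<t : s < t
  s<t with D-nonempty
  ... | x , Dx with inA x in Ax
  ...   | true  = <-≤-trans (m<m+n s (∈⇒1≤count inA Ax)) s+α≤t
  ...   | false = <-≤-trans (m<m+n s (∈⇒1≤count inB Dx)) s+β≤t

  s+3≤μ : s + 3 ≤ μ
  s+3≤μ = +-cancelˡ-≤ (s + α + β) (s + 3) μ (begin
    s + α + β + (s + 3)       ≡⟨ regroup s α β ⟩
    (s + α) + (s + β) + 3     ≤⟨ +-monoˡ-≤ 3 (+-mono-≤ s+α≤t s+β≤t) ⟩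
    t + t + 3                 ≡⟨ cong (λ x → t + x + 3) (+-identityʳ t) ⟨
    2 * t + 3                 ≤⟨ 2t+3≤n ⟩
    n                         ≡⟨ trans n≡∣Z∣+μ (cong (_+ μ) ∣Z∣≡s+α+β) ⟩
    s + α + β + μ             ∎)
    where
    open ≤-Reasoning
    regroup : ∀ s α β → s + α + β + (s + 3) ≡ (s + α) + (s + β) + 3
    regroup = solve-∀

  U⇒∉ : ∀ {u} → inU u ≡ true → u ∉ F₁ ∪ F₂
  U⇒∉ {u} Uu = false⇒∉ (trans (lookup-∪ F₁ F₂ u) (not≡true⇒≡false Uu))

  A⇒∈ : ∀ {x} → inA x ≡ true → x ∈ F₁ ─ F₂
  A⇒∈ {x} Ax = true⇒∈ (trans (lookup-─ F₁ F₂ x) Ax)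

  B⇒∈ : ∀ {x} → inB x ≡ true → x ∈ F₂ ─ F₁
  B⇒∈ {x} Bx = true⇒∈ (trans (lookup-─ F₂ F₁ x) Bx)

  D⇒∈ : ∀ {x} → inD x ≡ true → x ∈ F₁ △ F₂
  D⇒∈ {x} Dx = true⇒∈
    (trans (lookup-∪ (F₁ ─ F₂) (F₂ ─ F₁) x) (trans (cong₂ _∨_ (lookup-─ F₁ F₂ x) (lookup-─ F₂ F₁ x)) Dx))

  no-cond₁ : ∀ {u w d} → inU u ≡ true → inU w ≡ true → inD d ≡ true → Edge G′ u d → Edge G′ u w → ⊥
  no-cond₁ Uu Uw Dd ud uw = ¬cond₁ (_ , _ , _ , U⇒∉ Uu , U⇒∉ Uw , D⇒∈ Dd , ud , uw)

  no-cond₂ : ∀ {u v w} → u ≢ v → inA u ≡ true → inA v ≡ true → inU w ≡ true → Edge G′ u w → Edge G′ v w → ⊥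
  no-cond₂ u≢v Au Av Uw uw vw = ¬cond₂ (_ , _ , _ , u≢v , A⇒∈ Au , A⇒∈ Av , U⇒∉ Uw , uw , vw)

  no-cond₃ : ∀ {u v w} → u ≢ v → inB u ≡ true → inB v ≡ true → inU w ≡ true → Edge G′ u w → Edge G′ v w → ⊥
  no-cond₃ u≢v Bu Bv Uw uw vw = ¬cond₃ (_ , _ , _ , u≢v , B⇒∈ Bu , B⇒∈ Bv , U⇒∉ Uw , uw , vw)

  nbrs-in : (Fin n → Bool) → Fin n → ℕ
  nbrs-in P u = count (λ x → adj G′ u x ∧ P x)

  hasD : Fin n → Bool
  hasD u = positive (nbrs-in inD u)

  hasD⇒∃ : ∀ {u} → hasD u ≡ true → ∃ λ d → Edge G′ u d × inD d ≡ true
  hasD⇒∃ {u} hasDu with 1≤count⇒∃ (λ d → adj G′ u d ∧ inD d) (positive⇒1≤ hasDu)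
  ... | d , ud∧Dd = d , ∧-conicalˡ (adj G′ u d) (inD d) ud∧Dd , ∧-conicalʳ (adj G′ u d) (inD d) ud∧Dd

  ∃⇒hasD : ∀ {u d} → Edge G′ u d → inD d ≡ true → hasD u ≡ true
  ∃⇒hasD {u} ud Dd = 1≤⇒positive (∈⇒1≤count (λ d → adj G′ u d ∧ inD d) (∧-true ud Dd))

  inD⁺ : Fin n → Bool
  inD⁺ x = inD x ∨ (inU x ∧ hasD x)

  open Separation G F (t + h) δ≤deg δ≤κ inS inD⁺ using (δ≤T+edgeCount) renaming (Y to inU⁻)

  D⁺∩S≡∅ : ∀ x → inD⁺ x ≡ true → inS x ≡ false
  D⁺∩S≡∅ x = classify (inF₁ x) (inF₂ x) (hasD x)
    where
    classify : ∀ a b e → ((a ∧ not b) ∨ (b ∧ not a)) ∨ (not (a ∨ b) ∧ e) ≡ true → a ∧ b ≡ false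
    classify true  true  e ()
    classify true  false e _ = refl
    classify false b     e _ = refl

  U⁻⇒U∧¬hasD : ∀ y → inU⁻ y ≡ true → inU y ≡ true × hasD y ≡ false
  U⁻⇒U∧¬hasD y = classify (inF₁ y) (inF₂ y) (hasD y)
    where
    classify : ∀ a b e → not ((a ∧ b) ∨ (((a ∧ not b) ∨ (b ∧ not a)) ∨ (not (a ∨ b) ∧ e))) ≡ true →
      not (a ∨ b) ≡ true × e ≡ false
    classify true  true  e ()
    classify true  false e ()
    classify false true  e ()
    classify false false e ¬e = refl , not≡true⇒≡false ¬e

  U∧¬hasD⇒U⁻ : ∀ y → inU y ≡ true → hasD y ≡ false → inU⁻ y ≡ true
  U∧¬hasD⇒U⁻ y = classify (inF₁ y) (inF₂ y) (hasD y)
    where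
    classify : ∀ a b e → not (a ∨ b) ≡ true → e ≡ false →
      not ((a ∧ b) ∨ (((a ∧ not b) ∨ (b ∧ not a)) ∨ (not (a ∨ b) ∧ e))) ≡ true
    classify false false e _ refl = refl

  no-D⁺-U⁻-edge : ∀ x y → inD⁺ x ≡ true → inU⁻ y ≡ true → ¬ Edge G′ x y
  no-D⁺-U⁻-edge x y D⁺x U⁻y xy with U⁻⇒U∧¬hasD y U⁻y | inD x in Dx
  ... | Uy , ¬hasDy | true  with trans (≡.sym ¬hasDy) (∃⇒hasD (Edge-sym G′ xy) Dx)
  ...   | ()
  no-D⁺-U⁻-edge x y D⁺x U⁻y xy | Uy , ¬hasDy | false
    with hasD⇒∃ (∧-conicalʳ (inU x) (hasD x) D⁺x)
  ...   | d , xd , Dd = no-cond₁ (∧-conicalˡ (inU x) (hasD x) D⁺x) Uy Dd xd xy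

  -- Otherwise G′ has no edge between D⁺ and the nonempty set U⁻, and removing
  -- the s vertices of S and at most h faulty edges cannot separate G.
  U⇒hasD : ∀ {u} → inU u ≡ true → hasD u ≡ true
  U⇒hasD {u} Uu with hasD u in hasDu
  ... | true  = refl
  ... | false = ⊥-elim (<⇒≱ s<t (+-cancelʳ-≤ h t s (begin
    t + h             ≤⟨ δ≤T+edgeCount D⁺∩S≡∅ no-D⁺-U⁻-edge D⁺x₀ (U∧¬hasD⇒U⁻ u Uu hasDu) ⟩
    s + edgeCount F   ≤⟨ +-monoʳ-≤ s ∣F∣≤h ⟩
    s + h             ∎)))
    where
    open ≤-Reasoning
    D⁺x₀ : inD⁺ (proj₁ D-nonempty) ≡ true
    D⁺x₀ rewrite proj₂ D-nonempty = refl

  U-independent : ∀ {u w} → inU u ≡ true → Edge G′ u w → inU w ≡ false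
  U-independent {u} {w} Uu uw with inU w in Uw
  ... | false = refl
  ... | true with hasD⇒∃ (U⇒hasD Uu)
  ...   | d , ud , Dd = ⊥-elim (no-cond₁ Uu Uw Dd ud uw)

  nbrs-in≤1 : (P : Fin n → Bool) →
    (∀ {v w u} → v ≢ w → P v ≡ true → P w ≡ true → inU u ≡ true → Edge G′ v u → Edge G′ w u → ⊥) →
    ∀ {u} → inU u ≡ true → nbrs-in P u ≤ 1
  nbrs-in≤1 P no-cond {u} Uu = unique⇒count≤1 (λ x → adj G′ u x ∧ P x) unique
    where
    unique : ∀ i j → adj G′ u i ∧ P i ≡ true → adj G′ u j ∧ P j ≡ true → i ≡ j
    unique i j ui∧Pi uj∧Pj with i Fin.≟ j
    ... | yes i≡j = i≡j
    ... | no  i≢j = ⊥-elim (no-cond i≢j (∧-conicalʳ (adj G′ u i) (P i) ui∧Pi) (∧-conicalʳ (adj G′ u j) (P j) uj∧Pj) Uu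
                      (Edge-sym G′ (∧-conicalˡ (adj G′ u i) (P i) ui∧Pi))
                      (Edge-sym G′ (∧-conicalˡ (adj G′ u j) (P j) uj∧Pj)))

  nbrs-in-S≤s : ∀ u → nbrs-in inS u ≤ s
  nbrs-in-S≤s u = count-mono λ x → ∧-conicalʳ (adj G′ u x) (inS x)

  deg-U : ∀ {u} → inU u ≡ true → t + h ≤ nbrs-in inS u + nbrs-in inA u + nbrs-in inB u + faults u
  deg-U {u} Uu = begin
    t + h                                                   ≤⟨ δ≤deg u ⟩
    deg G u                                                 ≤⟨ deg≤deg-removeEdges+faults G F u ⟩
    count (adj G′ u) + faults u                             ≤⟨ +-monoˡ-≤ (faults u) (sum-mono-≤ λ x → in-S-A-or-B x) ⟩
    ∑[ x < n ] (𝟙 (adj G′ u x ∧ inS x) + 𝟙 (adj G′ u x ∧ inA x) + 𝟙 (adj G′ u x ∧ inB x)) + faults u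
      ≡⟨ cong (_+ faults u) (∑-distrib-+₃ (λ x → 𝟙 (adj G′ u x ∧ inS x)) (λ x → 𝟙 (adj G′ u x ∧ inA x))
                                          (λ x → 𝟙 (adj G′ u x ∧ inB x))) ⟩
    nbrs-in inS u + nbrs-in inA u + nbrs-in inB u + faults u ∎
    where
    open ≤-Reasoning
    classify : ∀ a b → not (a ∨ b) ≡ false → 1 ≤ 𝟙 (a ∧ b) + 𝟙 (a ∧ not b) + 𝟙 (b ∧ not a)
    classify true  true  _ = s≤s z≤n
    classify true  false _ = s≤s z≤n
    classify false true  _ = s≤s z≤n
    in-S-A-or-B : ∀ x → 𝟙 (adj G′ u x) ≤ 𝟙 (adj G′ u x ∧ inS x) + 𝟙 (adj G′ u x ∧ inA x) + 𝟙 (adj G′ u x ∧ inB x)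
    in-S-A-or-B x with adj G′ u x in ux
    ... | false = z≤n
    ... | true  = classify (inF₁ x) (inF₂ x) (U-independent Uu ux)

  deg-U≤s+2+faults : ∀ {u} → inU u ≡ true → t + h ≤ s + 2 + faults u
  deg-U≤s+2+faults {u} Uu = ≤-trans (deg-U Uu) (+-monoˡ-≤ (faults u)
    (≤-trans (+-mono-≤ (+-mono-≤ (nbrs-in-S≤s u) (nbrs-in≤1 inA no-cond₂ Uu)) (nbrs-in≤1 inB no-cond₃ Uu))
             (≤-reflexive (+-assoc s 1 1))))

  ∑faults≤2h : ∑[ u < n ] faults u ≤ 2 * h
  ∑faults≤2h = ≤-trans (≤-reflexive (∑deg≡2*edgeCount F)) (*-monoʳ-≤ 2 ∣F∣≤h)

  -- With δ = s + 3 + k, every U-vertex is incident with at least k + 1 faulty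
  -- edges, and μ ≥ s + 3 such vertices need more than the 2h edge ends.
  s+3≤δ⇒⊥ : s + 3 ≤ t + h → ⊥
  s+3≤δ⇒⊥ s+3≤δ = <-irrefl refl (begin-strict
    t + h                                    ≡⟨ δ≡s+3+k ⟩
    s + 3 + k                                ≤⟨ +-mono-≤ s+3≤μ k≤k*μ ⟩
    suc k * μ                                ≡⟨ *-distribˡ-sum (suc k) (𝟙 ∘ inU) ⟩
    ∑[ u < n ] (suc k * 𝟙 (inU u))           ≤⟨ sum-mono-≤ k<faults ⟩
    ∑[ u < n ] faults u                      ≤⟨ ∑faults≤2h ⟩
    2 * h                                    ≡⟨ cong (h +_) (+-identityʳ h) ⟩
    h + h                                    <⟨ +-monoˡ-< h h<t ⟩
    t + h                                    ∎)
    where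
    open ≤-Reasoning
    k : ℕ
    k = t + h ∸ (s + 3)
    δ≡s+3+k : t + h ≡ s + 3 + k
    δ≡s+3+k = ≡.sym (m+[n∸m]≡n s+3≤δ)
    k≤k*μ : k ≤ k * μ
    k≤k*μ = ≤-trans (≤-reflexive (≡.sym (*-identityʳ k))) (*-monoʳ-≤ k (≤-trans (s≤s z≤n) (≤-trans (m≤n+m 3 s) s+3≤μ)))
    k<faults : ∀ u → suc k * 𝟙 (inU u) ≤ faults u
    k<faults u with inU u in Uu
    ... | false = ≤-trans (≤-reflexive (*-zeroʳ (suc k))) z≤n
    ... | true  = ≤-trans (≤-reflexive (*-identityʳ (suc k))) (+-cancelˡ-≤ (s + 2) (suc k) (faults u) (begin
      s + 2 + suc k    ≡⟨ shift s k ⟩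
      s + 3 + k        ≡⟨ δ≡s+3+k ⟨
      t + h            ≤⟨ deg-U≤s+2+faults Uu ⟩
      s + 2 + faults u ∎))
      where
      shift : ∀ s k → s + 2 + suc k ≡ s + 3 + k
      shift = solve-∀

  δ≡s+ : ∀ {a b} → t ≡ s + a → h ≡ b → t + h ≡ s + (a + b)
  δ≡s+ t≡s+a h≡b = trans (cong₂ _+_ t≡s+a h≡b) (+-assoc s _ _)

  common≤c : ∀ {u v} → u ≢ v → count (λ x → adj G u x ∧ adj G v x) ≤ c
  common≤c {u} {v} u≢v = ≤-trans (≤-reflexive (≡.sym (∣N∩N∣≡count G u v))) (C≤c u v u≢v)

  faulty : Fin n → Bool
  faulty u = positive (faults u)

  ∣faulty∣≤2h : count faulty ≤ 2 * h
  ∣faulty∣≤2h = ≤-trans (sum-mono-≤ λ u → 𝟙-pos (faults u)) ∑faults≤2h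
    where
    𝟙-pos : ∀ f → 𝟙 (positive f) ≤ f
    𝟙-pos zero    = z≤n
    𝟙-pos (suc f) = s≤s z≤n

  fault-free⇒faults≡0 : ∀ {u} → not (faulty u) ≡ true → faults u ≡ 0
  fault-free⇒faults≡0 {u} = go (faults u)
    where
    go : ∀ f → not (positive f) ≡ true → f ≡ 0
    go zero _ = refl

  fault-free-U⇒N⊆Z : ∀ {u} → inU u ≡ true → not (faulty u) ≡ true → adj G u ⊆ᵇ inZ
  fault-free-U⇒N⊆Z {u} Uu fault-free x Gux =
    not-injective (U-independent Uu (∧-true Gux (cong not (count≡0⇒false (adj F u) (fault-free⇒faults≡0 fault-free) x))))

  t≡s+1⇒∣Z∣≤s+2 : t ≡ s + 1 → count inZ ≤ s + 2
  t≡s+1⇒∣Z∣≤s+2 t≡s+1 = begin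
    count inZ      ≡⟨ ∣Z∣≡s+α+β ⟩
    s + α + β      ≤⟨ +-mono-≤ (+-monoʳ-≤ s (≤1 s+α≤t)) (≤1 s+β≤t) ⟩
    s + 1 + 1      ≡⟨ +-assoc s 1 1 ⟩
    s + 2          ∎
    where
    open ≤-Reasoning
    ≤1 : ∀ {a} → s + a ≤ t → a ≤ 1
    ≤1 {a} s+a≤t = +-cancelˡ-≤ s a 1 (≤-trans s+a≤t (≤-reflexive t≡s+1))

  h≡1⇒2≤∣fault-free-U∣ : h ≡ 1 → 3 ≤ s + 2 → 2 ≤ count (λ u → inU u ∧ not (faulty u))
  h≡1⇒2≤∣fault-free-U∣ h≡1 3≤s+2 = +-cancelˡ-≤ 2 2 (count fault-free-U) (begin
    4                                                       ≤⟨ +-monoˡ-≤ 3 (+-cancelʳ-≤ 2 1 s 3≤s+2) ⟩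
    s + 3                                                   ≤⟨ s+3≤μ ⟩
    μ                                                       ≡⟨ count-split inU faulty ⟩
    count (λ u → inU u ∧ faulty u) + count fault-free-U     ≤⟨ +-monoˡ-≤ (count fault-free-U) ∣faulty-U∣≤2 ⟩
    2 + count fault-free-U                                  ∎)
    where
    open ≤-Reasoning
    fault-free-U : Fin n → Bool
    fault-free-U u = inU u ∧ not (faulty u)
    ∣faulty-U∣≤2 : count (λ u → inU u ∧ faulty u) ≤ 2
    ∣faulty-U∣≤2 = ≤-trans (count-mono (λ u → ∧-conicalʳ (inU u) (faulty u)))
                           (≤-trans ∣faulty∣≤2h (≤-reflexive (cong (2 *_) h≡1)))

  -- With a single faulty edge two U-vertices are fault-free; their
  -- neighbourhoods lie in F₁ ∪ F₂, which has only δ vertices.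
  h≡1⇒⊥ : h ≡ 1 → t ≡ s + 1 → ⊥
  h≡1⇒⊥ h≡1 t≡s+1 =
    case 2≤count⇒∃ (λ u → inU u ∧ not (faulty u)) (h≡1⇒2≤∣fault-free-U∣ h≡1 (≤-trans 3≤δ (≤-reflexive δ≡s+2))) of λ where
      (u₁ , u₂ , u₁≢u₂ , ff₁ , ff₂) →
        neighbourhoods-not-within G inZ (δ≤deg u₁) (δ≤deg u₂) (common≤c u₁≢u₂) c<δ (N⊆Z ff₁) (N⊆Z ff₂)
          (≤-trans (t≡s+1⇒∣Z∣≤s+2 t≡s+1) (≤-reflexive (≡.sym δ≡s+2)))
    where
    δ≡s+2 : t + h ≡ s + 2
    δ≡s+2 = δ≡s+ t≡s+1 h≡1
    N⊆Z : ∀ {u} → inU u ∧ not (faulty u) ≡ true → adj G u ⊆ᵇ inZ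
    N⊆Z {u} ff = fault-free-U⇒N⊆Z (∧-conicalˡ (inU u) _ ff) (∧-conicalʳ (inU u) _ ff)

  h≡0⇒fault-free : h ≡ 0 → ∀ u → not (faulty u) ≡ true
  h≡0⇒fault-free h≡0 u =
    cong not (count≡0⇒false faulty (n≤0⇒n≡0 (≤-trans ∣faulty∣≤2h (≤-reflexive (cong (2 *_) h≡0)))) u)

  missing : Fin n → Fin n → Bool
  missing z u = inU u ∧ not (adj G u z)

  -- Two U-vertices missing the same z ∈ F₁ ∪ F₂ would have their
  -- neighbourhoods inside the δ vertices of (F₁ ∪ F₂) − z.
  h≡0⇒∣U-missing∣≤1 : h ≡ 0 → t ≡ s + 1 → ∀ {z} → inZ z ≡ true → count (missing z) ≤ 1
  h≡0⇒∣U-missing∣≤1 h≡0 t≡s+1 {z} Zz = unique⇒count≤1 (missing z) unique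
    where
    ∣Z-z∣≤δ : count (inZ without z) ≤ t + h
    ∣Z-z∣≤δ = s≤s⁻¹ (begin
      suc (count (inZ without z))   ≡⟨ count-remove inZ Zz ⟨
      count inZ                     ≤⟨ t≡s+1⇒∣Z∣≤s+2 t≡s+1 ⟩
      s + 2                         ≡⟨ +-suc s 1 ⟩
      suc (s + 1)                   ≡⟨ cong suc (δ≡s+ t≡s+1 h≡0) ⟨
      suc (t + h)                   ∎)
      where open ≤-Reasoning
    N⊆Z-z : ∀ {u} → missing z u ≡ true → adj G u ⊆ᵇ inZ without z
    N⊆Z-z {u} Uu∧¬uz x ux = ∈-without inZ (fault-free-U⇒N⊆Z Uu (h≡0⇒fault-free h≡0 u) x ux) x≢z
      where
      Uu = ∧-conicalˡ (inU u) _ Uu∧¬uz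
      x≢z : x ≢ z
      x≢z refl with trans (≡.sym (not-injective (∧-conicalʳ (inU u) _ Uu∧¬uz))) ux
      ... | ()
    unique : ∀ i j → missing z i ≡ true → missing z j ≡ true → i ≡ j
    unique i j Ui Uj with i Fin.≟ j
    ... | yes i≡j = i≡j
    ... | no  i≢j = ⊥-elim (neighbourhoods-not-within G (inZ without z) (δ≤deg i) (δ≤deg j)
                      (common≤c i≢j) c<δ (N⊆Z-z Ui) (N⊆Z-z Uj) ∣Z-z∣≤δ)

  -- A U-vertex has two neighbours x, y in F₁ ∪ F₂, and all but at most two
  -- U-vertices are common neighbours of x and y.
  h≡0⇒t≢s+1 : h ≡ 0 → t ≡ s + 1 → ⊥
  h≡0⇒t≢s+1 h≡0 t≡s+1 with 1≤count⇒∃ inU (≤-trans (s≤s z≤n) (≤-trans (m≤n+m 3 s) s+3≤μ))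
  ... | u₀ , Uu₀
    with 2≤count⇒∃ (adj G u₀) (≤-trans (≤-trans (n≤1+n 2) 3≤δ) (≤-trans (δ≤deg u₀) (≤-reflexive (deg≡count G u₀))))
  ...   | x , y , x≢y , u₀x , u₀y = <-irrefl refl (begin-strict
    s + 1     ≤⟨ +-cancelʳ-≤ 2 (s + 1) c s+1+2≤c+2 ⟩
    c         <⟨ c<δ ⟩
    t + h     ≡⟨ δ≡s+ t≡s+1 h≡0 ⟩
    s + 1     ∎)
    where
    open ≤-Reasoning
    Zx = fault-free-U⇒N⊆Z Uu₀ (h≡0⇒fault-free h≡0 u₀) x u₀x
    Zy = fault-free-U⇒N⊆Z Uu₀ (h≡0⇒fault-free h≡0 u₀) y u₀y
    covered : ∀ u → 𝟙 (inU u) ≤ 𝟙 (adj G x u ∧ adj G y u) + 𝟙 (missing x u) + 𝟙 (missing y u)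
    covered u rewrite sym G x u | sym G y u with inU u | adj G u x | adj G u y
    ... | false | _     | _     = z≤n
    ... | true  | true  | true  = s≤s z≤n
    ... | true  | true  | false = s≤s z≤n
    ... | true  | false | _     = s≤s z≤n
    s+1+2≤c+2 : s + 1 + 2 ≤ c + 2
    s+1+2≤c+2 = begin
      s + 1 + 2                                                      ≡⟨ +-assoc s 1 2 ⟩
      s + 3                                                          ≤⟨ s+3≤μ ⟩
      μ                                                              ≤⟨ sum-mono-≤ covered ⟩
      ∑[ u < n ] (𝟙 (adj G x u ∧ adj G y u) + 𝟙 (missing x u) + 𝟙 (missing y u))
        ≡⟨ ∑-distrib-+₃ (λ u → 𝟙 (adj G x u ∧ adj G y u)) (𝟙 ∘ missing x) (𝟙 ∘ missing y) ⟩
      count (λ u → adj G x u ∧ adj G y u) + count (missing x) + count (missing y)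
        ≤⟨ +-mono-≤ (+-mono-≤ (common≤c x≢y) (h≡0⇒∣U-missing∣≤1 h≡0 t≡s+1 Zx))
                    (h≡0⇒∣U-missing∣≤1 h≡0 t≡s+1 Zy) ⟩
      c + 1 + 1                                                      ≡⟨ +-assoc c 1 1 ⟩
      c + 2                                                          ∎

  module _ (h≡0 : h ≡ 0) (t≡s+2 : t ≡ s + 2) where

    -- The degree bound is tight: every U-vertex sees all of S and a vertex of A.
    U-sees-S-and-A : ∀ {u} → inU u ≡ true → s ≤ nbrs-in inS u × 1 ≤ nbrs-in inA u
    U-sees-S-and-A {u} Uu = tight (nbrs-in-S≤s u) (nbrs-in≤1 inA no-cond₂ Uu) (nbrs-in≤1 inB no-cond₃ Uu) (begin
      s + 2                                                       ≡⟨ δ≡s+ t≡s+2 h≡0 ⟨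
      t + h                                                       ≤⟨ deg-U Uu ⟩
      nbrs-in inS u + nbrs-in inA u + nbrs-in inB u + faults u
        ≡⟨ cong (nbrs-in inS u + nbrs-in inA u + nbrs-in inB u +_) (fault-free⇒faults≡0 (h≡0⇒fault-free h≡0 u)) ⟩
      nbrs-in inS u + nbrs-in inA u + nbrs-in inB u + 0           ≡⟨ +-identityʳ _ ⟩
      nbrs-in inS u + nbrs-in inA u + nbrs-in inB u               ∎)
      where
      open ≤-Reasoning
      tight : ∀ {a b e} → a ≤ s → b ≤ 1 → e ≤ 1 → s + 2 ≤ a + b + e → s ≤ a × 1 ≤ b
      tight {a} {b} {e} a≤s b≤1 e≤1 s+2≤ =
        +-cancelʳ-≤ 2 s a (≤-trans s+2≤ (≤-trans (+-mono-≤ (+-monoʳ-≤ a b≤1) e≤1) (≤-reflexive (+-assoc a 1 1)))) ,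
        +-cancelˡ-≤ (s + 1) 1 b (begin
          s + 1 + 1     ≡⟨ +-assoc s 1 1 ⟩
          s + 2         ≤⟨ s+2≤ ⟩
          a + b + e     ≤⟨ +-mono-≤ (+-monoˡ-≤ b a≤s) e≤1 ⟩
          s + b + 1     ≡⟨ +-assoc s b 1 ⟩
          s + (b + 1)   ≡⟨ cong (s +_) (+-comm b 1) ⟩
          s + (1 + b)   ≡⟨ +-assoc s 1 b ⟨
          s + 1 + b     ∎)

    S⊆N : ∀ {u} → inU u ≡ true → inS ⊆ᵇ adj G u
    S⊆N {u} Uu x Sx = ∧-conicalˡ (adj G u x) _ (∧-conicalˡ (adj G′ u x) (inS x)
      (⊆-count≥⇒⊇ (λ y → ∧-conicalʳ (adj G′ u y) (inS y)) (proj₁ (U-sees-S-and-A Uu)) x Sx))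

    -- Two vertices of S would have all of U as common neighbours.
    1<s⇒⊥ : 1 < s → ⊥
    1<s⇒⊥ 1<s with 2≤count⇒∃ inS 1<s
    ... | q₁ , q₂ , q₁≢q₂ , Sq₁ , Sq₂ = <-irrefl refl (begin-strict
      s + 3                                  ≤⟨ s+3≤μ ⟩
      μ                                      ≤⟨ count-mono U⊆common ⟩
      count (λ x → adj G q₁ x ∧ adj G q₂ x)  ≤⟨ common≤c q₁≢q₂ ⟩
      c                                      <⟨ c<δ ⟩
      t + h                                  ≡⟨ δ≡s+ t≡s+2 h≡0 ⟩
      s + 2                                  <⟨ +-monoʳ-< s ≤-refl ⟩
      s + 3                                  ∎)
      where
      open ≤-Reasoning
      U⊆common : inU ⊆ᵇ (λ x → adj G q₁ x ∧ adj G q₂ x)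
      U⊆common x Ux = ∧-true (Edge-sym G (S⊆N Ux q₁ Sq₁)) (Edge-sym G (S⊆N Ux q₂ Sq₂))

    1≤s : 1 ≤ s
    1≤s = +-cancelʳ-≤ 2 1 s (≤-trans 3≤δ (≤-reflexive (δ≡s+ t≡s+2 h≡0)))

    A-neighbour : ∀ {u} → inU u ≡ true → ∃ λ a → Edge G u a × inA a ≡ true
    A-neighbour {u} Uu = case 1≤count⇒∃ (λ a → adj G′ u a ∧ inA a) (proj₂ (U-sees-S-and-A Uu)) of λ where
      (a , ua∧Aa) → a , ∧-conicalˡ (adj G u a) _ (∧-conicalˡ (adj G′ u a) (inA a) ua∧Aa) ,
                        ∧-conicalʳ (adj G′ u a) (inA a) ua∧Aa

    -- With s = 1 we have δ = 3, hence c ≤ 1, and two U-vertices sharing their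
    -- A-neighbour have the vertex of S as a second common neighbour.
    shared-A-neighbour⇒⊥ : s ≤ 1 → ∀ {u v a} → u ≢ v → inU u ≡ true → inU v ≡ true →
      Edge G u a → Edge G v a → inA a ≡ true → ⊥
    shared-A-neighbour⇒⊥ s≤1 {u} {v} {a} u≢v Uu Uv ua va Aa = case 1≤count⇒∃ inS 1≤s of λ where
        (s₀ , Ss₀) → 1+n≰n (begin
          2                                       ≤⟨ 2≤count (λ x → adj G u x ∧ adj G v x) (s₀≢a Ss₀)
                                                       (∧-true (S⊆N Uu s₀ Ss₀) (S⊆N Uv s₀ Ss₀)) (∧-true ua va) ⟩
          count (λ x → adj G u x ∧ adj G v x)     ≤⟨ common≤c u≢v ⟩
          c                                       ≤⟨ δ≡3⇒c≤1 (trans (δ≡s+ t≡s+2 h≡0) (cong (_+ 2) (≤-antisym s≤1 1≤s))) ⟩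
          1                                       ∎)
      where
      open ≤-Reasoning
      s₀≢a : ∀ {s₀} → inS s₀ ≡ true → s₀ ≢ a
      s₀≢a {s₀} Ss₀ refl = S∩A≡∅ (inF₁ s₀) (inF₂ s₀) Ss₀ Aa
        where
        S∩A≡∅ : ∀ a b → a ∧ b ≡ true → a ∧ not b ≡ true → ⊥
        S∩A≡∅ true true _ ()

    distinct-A-neighbours : s ≤ 1 → ∀ {u v} → u ≢ v → (Uu : inU u ≡ true) (Uv : inU v ≡ true) →
      proj₁ (A-neighbour Uu) ≢ proj₁ (A-neighbour Uv)
    distinct-A-neighbours s≤1 {v = v} u≢v Uu Uv a≡a′ =
      shared-A-neighbour⇒⊥ s≤1 u≢v Uu Uv (proj₁ (proj₂ (A-neighbour Uu)))
        (subst (Edge G v) (≡.sym a≡a′) (proj₁ (proj₂ (A-neighbour Uv)))) (proj₂ (proj₂ (A-neighbour Uu)))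

    s≤1⇒⊥ : s ≤ 1 → ⊥
    s≤1⇒⊥ s≤1 = case 3≤count⇒∃ inU (≤-trans (m≤n+m 3 s) s+3≤μ) of λ where
        (u₁ , u₂ , u₃ , u₁≢u₂ , u₁≢u₃ , u₂≢u₃ , Uu₁ , Uu₂ , Uu₃) →
          case count≤2-pigeonhole inA α≤2 (A∋ Uu₁) (A∋ Uu₂) (A∋ Uu₃) of λ where
            (inj₁ a₁≡a₂)        → distinct-A-neighbours s≤1 u₁≢u₂ Uu₁ Uu₂ a₁≡a₂
            (inj₂ (inj₁ a₁≡a₃)) → distinct-A-neighbours s≤1 u₁≢u₃ Uu₁ Uu₃ a₁≡a₃
            (inj₂ (inj₂ a₂≡a₃)) → distinct-A-neighbours s≤1 u₂≢u₃ Uu₂ Uu₃ a₂≡a₃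
      where
      α≤2 : α ≤ 2
      α≤2 = +-cancelˡ-≤ s α 2 (≤-trans s+α≤t (≤-reflexive t≡s+2))
      A∋ : ∀ {u} (Uu : inU u ≡ true) → inA (proj₁ (A-neighbour Uu)) ≡ true
      A∋ Uu = proj₂ (proj₂ (A-neighbour Uu))

  impossible : ⊥
  impossible with s + 3 ≤? t + h
  ... | yes s+3≤δ = s+3≤δ⇒⊥ s+3≤δ
  ... | no  s+3≰δ with δ≤s+2-cases h s<t (s≤s⁻¹ (≤-trans (≰⇒> s+3≰δ) (≤-reflexive (+-suc s 2))))
  ...   | inj₁ (h≡1 , t≡s+1)        = h≡1⇒⊥ h≡1 t≡s+1
  ...   | inj₂ (inj₁ (h≡0 , t≡s+1)) = h≡0⇒t≢s+1 h≡0 t≡s+1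
  ...   | inj₂ (inj₂ (h≡0 , t≡s+2)) with s ≤? 1
  ...     | yes s≤1 = s≤1⇒⊥ h≡0 t≡s+2 s≤1
  ...     | no  s≰1 = 1<s⇒⊥ h≡0 t≡s+2 (≰⇒> s≰1)

Cond1? : ∀ {n} (H : Graph n) F₁ F₂ → Dec (Cond1 H F₁ F₂)
Cond1? H F₁ F₂ = Fin.any? λ u → Fin.any? λ w → Fin.any? λ v →
  ¬? (u ∈? F₁ ∪ F₂) ×-dec ¬? (w ∈? F₁ ∪ F₂) ×-dec v ∈? F₁ △ F₂ ×-dec adj H u v Bool.≟ true ×-dec adj H u w Bool.≟ true

Cond23? : ∀ {n} (H : Graph n) A F₁ F₂ → Dec (Cond23 H A F₁ F₂)
Cond23? H A F₁ F₂ = Fin.any? λ u → Fin.any? λ v → Fin.any? λ w →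
  ¬? (u Fin.≟ v) ×-dec u ∈? A ×-dec v ∈? A ×-dec ¬? (w ∈? F₁ ∪ F₂) ×-dec adj H u w Bool.≟ true ×-dec adj H v w Bool.≟ true

Diagnosable-by-contradiction : ∀ {n} (H : Graph n) t →
  (∀ F₁ F₂ → F₁ ≢ F₂ → ∣ F₁ ∣ ≤ t → ∣ F₂ ∣ ≤ t →
    ¬ Cond1 H F₁ F₂ → ¬ Cond23 H (F₁ ─ F₂) F₁ F₂ → ¬ Cond23 H (F₂ ─ F₁) F₁ F₂ → ⊥) →
  Diagnosable H t
Diagnosable-by-contradiction H t no-pair F₁ F₂ F₁≢F₂ ∣F₁∣≤t ∣F₂∣≤t
  with Cond1? H F₁ F₂ | Cond23? H (F₁ ─ F₂) F₁ F₂ | Cond23? H (F₂ ─ F₁) F₁ F₂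
... | yes c₁ | _      | _      = inj₁ c₁
... | no _   | yes c₂ | _      = inj₂ (inj₁ c₂)
... | no _   | no _   | yes c₃ = inj₂ (inj₂ c₃)
... | no ¬c₁ | no ¬c₂ | no ¬c₃ = ⊥-elim (no-pair F₁ F₂ F₁≢F₂ ∣F₁∣≤t ∣F₂∣≤t ¬c₁ ¬c₂ ¬c₃)

-- Removing edges that are not in G is harmless.
lower-bound : ∀ {n} (G : Graph n) {δ t h c} → t + h ≡ δ →
  (∀ v → δ ≤ deg G v) → (∀ S → DisconnectedOrTrivial G S → δ ≤ ∣ S ∣) →
  3 ≤ δ → c < δ → (δ ≡ 3 → c ≤ 1) → (∀ u v → u ≢ v → ∣ N G u ∩ N G v ∣ ≤ c) →
  h < t → 2 * t + 3 ≤ n → EdgeTolerableDiagnosable G h t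
lower-bound G {t = t} {h} {c} refl δ≤deg δ≤κ 3≤δ c<δ δ≡3⇒c≤1 C≤c h<t 2t+3≤n F _ ∣F∣≤h =
  Diagnosable-by-contradiction (removeEdges G F) t λ F₁ F₂ F₁≢F₂ ∣F₁∣≤t ∣F₂∣≤t ¬c₁ ¬c₂ ¬c₃ →
    IndistinguishablePair.impossible G F t h c δ≤deg δ≤κ 3≤δ c<δ δ≡3⇒c≤1 C≤c h<t 2t+3≤n ∣F∣≤h
      F₁ F₂ F₁≢F₂ ∣F₁∣≤t ∣F₂∣≤t ¬c₁ ¬c₂ ¬c₃

-- The upper bound t_h^e(G) ≤ δ − h

-- N(v) and N(v) ∪ {v} cannot be told apart: the only vertex in their
-- difference is v, and all neighbours of v lie in N(v).
module NeighbourhoodPair {n} (H : Graph n) (v : Fin n) where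

  F₁ F₂ : Subset n
  F₁ = N H v
  F₂ = N H v ∪ ⁅ v ⁆

  lookup-F₂ : ∀ x → lookup F₂ x ≡ adj H v x ∨ (x == v)
  lookup-F₂ x = trans (lookup-∪ F₁ ⁅ v ⁆ x) (cong₂ _∨_ (lookup-N H v x) (lookup-⁅⁆ v x))

  F₁≢F₂ : F₁ ≢ F₂
  F₁≢F₂ F₁≡F₂ with begin
      false                       ≡⟨ irrefl H v ⟨
      adj H v v                   ≡⟨ lookup-N H v v ⟨
      lookup F₁ v                 ≡⟨ cong (λ p → lookup p v) F₁≡F₂ ⟩
      lookup F₂ v                 ≡⟨ lookup-F₂ v ⟩
      adj H v v ∨ (v == v)        ≡⟨ cong (adj H v v ∨_) (==-refl v) ⟩
      adj H v v ∨ true            ≡⟨ ∨-zeroʳ (adj H v v) ⟩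
      true                        ∎
    where open ≡-Reasoning
  ... | ()

  ∣F₂∣≤deg+1 : ∣ F₂ ∣ ≤ suc (deg H v)
  ∣F₂∣≤deg+1 = begin
    ∣ F₂ ∣                              ≡⟨ trans (∣p∣≡count F₂) (count-cong lookup-F₂) ⟩
    count (λ x → adj H v x ∨ (x == v))  ≤⟨ count-∨ (adj H v) (_== v) ⟩
    count (adj H v) + count (_== v)     ≡⟨ cong₂ _+_ (≡.sym (deg≡count H v)) (count-single v) ⟩
    deg H v + 1                         ≡⟨ +-comm (deg H v) 1 ⟩
    suc (deg H v)                       ∎
    where open ≤-Reasoning

  F₁─F₂≡∅ : ∀ x → x ∉ F₁ ─ F₂
  F₁─F₂≡∅ x x∈ = empty (adj H v x) (x == v) (begin
      adj H v x ∧ not (adj H v x ∨ (x == v))      ≡⟨ cong₂ (λ a b → a ∧ not b) (lookup-N H v x) (lookup-F₂ x) ⟨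
      lookup F₁ x ∧ not (lookup F₂ x)             ≡⟨ lookup-─ F₁ F₂ x ⟨
      lookup (F₁ ─ F₂) x                          ≡⟨ []=⇒lookup x∈ ⟩
      true                                        ∎)
    where
    open ≡-Reasoning
    empty : ∀ a b → a ∧ not (a ∨ b) ≡ true → ⊥
    empty true  b ()
    empty false b ()

  F₂─F₁⇒≡v : ∀ {x} → x ∈ F₂ ─ F₁ → x ≡ v
  F₂─F₁⇒≡v {x} x∈ = ==⇒≡ (only (adj H v x) (x == v) (begin
      (adj H v x ∨ (x == v)) ∧ not (adj H v x)   ≡⟨ cong₂ (λ a b → a ∧ not b) (lookup-F₂ x) (lookup-N H v x) ⟨
      lookup F₂ x ∧ not (lookup F₁ x)             ≡⟨ lookup-─ F₂ F₁ x ⟨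
      lookup (F₂ ─ F₁) x                          ≡⟨ []=⇒lookup x∈ ⟩
      true                                        ∎))
    where
    open ≡-Reasoning
    only : ∀ a b → (a ∨ b) ∧ not a ≡ true → b ≡ true
    only false true _ = refl

  △⇒≡v : ∀ {x} → x ∈ F₁ △ F₂ → x ≡ v
  △⇒≡v {x} x∈ with x∈p∪q⁻ (F₁ ─ F₂) (F₂ ─ F₁) x∈
  ... | inj₁ x∈F₁─F₂ = ⊥-elim (F₁─F₂≡∅ x x∈F₁─F₂)
  ... | inj₂ x∈F₂─F₁ = F₂─F₁⇒≡v x∈F₂─F₁

  indistinguishable : ¬ (Cond1 H F₁ F₂ ⊎ Cond23 H (F₁ ─ F₂) F₁ F₂ ⊎ Cond23 H (F₂ ─ F₁) F₁ F₂)
  indistinguishable (inj₁ (u , w , d , u∉ , w∉ , d∈ , ud , uw)) with △⇒≡v d∈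
  ... | refl = u∉ (x∈p∪q⁺ (inj₁ (true⇒∈ (trans (lookup-N H d u) (Edge-sym H ud)))))
  indistinguishable (inj₂ (inj₁ (u , _ , _ , _ , u∈ , _))) = F₁─F₂≡∅ u u∈
  indistinguishable (inj₂ (inj₂ (u , u′ , _ , u≢u′ , u∈ , u′∈ , _))) =
    u≢u′ (trans (F₂─F₁⇒≡v u∈) (≡.sym (F₂─F₁⇒≡v u′∈)))

deg<t⇒¬Diagnosable : ∀ {n} (H : Graph n) {t} v → deg H v < t → ¬ Diagnosable H t
deg<t⇒¬Diagnosable H v deg<t diagnosable =
  indistinguishable (diagnosable F₁ F₂ F₁≢F₂ (<⇒≤ deg<t) (≤-trans ∣F₂∣≤deg+1 deg<t))
  where open NeighbourhoodPair H v

subset-of-size : ∀ {n} (P : Fin n → Bool) k → k ≤ count P → ∃ λ K → K ⊆ᵇ P × count K ≡ k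
subset-of-size {zero}  P zero    _ = (λ ()) , (λ ()) , refl
subset-of-size {suc n} P k k≤∣P∣ with P zero in P0
subset-of-size {suc n} P zero    _      | true = (λ _ → false) , (λ _ ()) , sum-zero {suc n}
subset-of-size {suc n} P (suc k) k<∣P∣  | true with subset-of-size (P ∘ suc) k (s≤s⁻¹ k<∣P∣)
... | K , K⊆P , ∣K∣≡k = (λ { zero → true ; (suc i) → K i }) , (λ { zero _ → P0 ; (suc i) → K⊆P i }) , cong suc ∣K∣≡k
subset-of-size {suc n} P k       k≤∣P∣  | false with subset-of-size (P ∘ suc) k k≤∣P∣
... | K , K⊆P , ∣K∣≡k = (λ { zero → false ; (suc i) → K i }) , (λ { zero () ; (suc i) → K⊆P i }) , ∣K∣≡k

star : ∀ {n} (v : Fin n) (K : Fin n → Bool) → K v ≡ false → Graph n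
star v K Kv≡false = record
  { adj    = λ x y → (x == v ∧ K y) ∨ (K x ∧ y == v)
  ; sym    = λ x y → trans (∨-comm (x == v ∧ K y) (K x ∧ y == v)) (cong₂ _∨_ (∧-comm (K x) (y == v)) (∧-comm (x == v) (K y)))
  ; irrefl = irrefl′
  }
  where
  irrefl′ : ∀ x → (x == v ∧ K x) ∨ (K x ∧ x == v) ≡ false
  irrefl′ x with x Fin.≟ v
  ... | yes refl rewrite Kv≡false = refl
  ... | no  _    = ∧-zeroʳ (K x)

module Star {n} (v : Fin n) (K : Fin n → Bool) (Kv≡false : K v ≡ false) where

  S : Graph n
  S = star v K Kv≡false

  adj-star-v : ∀ x → adj S v x ≡ K x
  adj-star-v x rewrite ==-refl v | Kv≡false = trans (cong (K x ∨_) (∧-zeroˡ (x == v))) (∨-identityʳ (K x))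

  star⊆ : ∀ {G : Graph n} → K ⊆ᵇ adj G v → IsSubgraph S G
  star⊆ {G} K⊆N x y xy with ∨-true (x == v ∧ K y) xy
  ... | inj₁ x==v∧Ky with ==⇒≡ {i = x} {v} (∧-conicalˡ (x == v) (K y) x==v∧Ky)
  ...   | refl = K⊆N y (∧-conicalʳ (x == v) (K y) x==v∧Ky)
  star⊆ {G} K⊆N x y xy | inj₂ Kx∧y==v with ==⇒≡ {i = y} {v} (∧-conicalʳ (K x) (y == v) Kx∧y==v)
  ...   | refl = Edge-sym G (K⊆N x (∧-conicalˡ (K x) (y == v) Kx∧y==v))

  edgeCount-star≤ : edgeCount S ≤ count K
  edgeCount-star≤ = *-cancelˡ-≤ 2 (begin
    2 * edgeCount S                                               ≡⟨ ∑deg≡2*edgeCount S ⟨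
    ∑[ u < n ] count (adj S u)
      ≤⟨ sum-mono-≤ (λ u → count-∨ (λ w → u == v ∧ K w) (λ w → K u ∧ w == v)) ⟩
    ∑[ u < n ] (count (λ w → u == v ∧ K w) + count (λ w → K u ∧ w == v))
      ≡⟨ sum-cong-≗ (λ u → cong₂ _+_ (𝟙*count (u == v) K)
                                     (trans (cong (𝟙 (K u) *_) (≡.sym (count-single v))) (𝟙*count (K u) (_== v)))) ⟨
    ∑[ u < n ] (𝟙 (u == v) * count K + 𝟙 (K u) * 1)
      ≡⟨ ∑-distrib-+ (λ u → 𝟙 (u == v) * count K) (λ u → 𝟙 (K u) * 1) ⟩
    ∑[ u < n ] (𝟙 (u == v) * count K) + ∑[ u < n ] (𝟙 (K u) * 1)
      ≡⟨ cong₂ _+_ (∑-δ v (count K)) (sum-cong-≗ λ u → *-identityʳ (𝟙 (K u))) ⟩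
    count K + count K                                             ≡⟨ cong (count K +_) (+-identityʳ (count K)) ⟨
    2 * count K                                                   ∎)
    where open ≤-Reasoning

upper-bound : ∀ {n} (G : Graph n) {v h t} → h ≤ deg G v → EdgeTolerableDiagnosable G h t → t ≤ deg G v ∸ h
upper-bound {n} G {v} {h} {t} h≤deg tolerable with t ≤? deg G v ∸ h
... | yes t≤ = t≤
... | no  t≰ with subset-of-size (adj G v) h (≤-trans h≤deg (≤-reflexive (deg≡count G v)))
...   | K , K⊆N , ∣K∣≡h =
  ⊥-elim (deg<t⇒¬Diagnosable H v deg-H<t (tolerable S (star⊆ {G} K⊆N) (≤-trans edgeCount-star≤ (≤-reflexive ∣K∣≡h))))
  where
  Kv≡false : K v ≡ false
  Kv≡false with K v in Kv
  ... | false = refl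
  ... | true  = ⊥-elim (Edge⇒≢ G (K⊆N v Kv) refl)
  open Star v K Kv≡false
  H : Graph n
  H = removeEdges G S
  deg-G≡h+deg-H : deg G v ≡ h + deg H v
  deg-G≡h+deg-H = begin
    deg G v                                                           ≡⟨ deg≡count G v ⟩
    count (adj G v)                                                   ≡⟨ count-split (adj G v) K ⟩
    count (λ x → adj G v x ∧ K x) + count (λ x → adj G v x ∧ not (K x))
      ≡⟨ cong₂ _+_ (trans (count-cong K-part) ∣K∣≡h) (count-cong H-part) ⟩
    h + count (adj H v)                                               ≡⟨ cong (h +_) (deg≡count H v) ⟨
    h + deg H v                                                       ∎
    where
    open ≡-Reasoning
    K-part : ∀ x → adj G v x ∧ K x ≡ K x
    K-part x with K x in Kx
    ... | true  rewrite K⊆N x Kx = refl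
    ... | false = ∧-zeroʳ (adj G v x)
    H-part : ∀ x → adj G v x ∧ not (K x) ≡ adj H v x
    H-part x = cong (λ b → adj G v x ∧ not b) (≡.sym (adj-star-v x))
  deg-H<t : deg H v < t
  deg-H<t = ≤-trans (≤-reflexive (cong suc (≡.sym (trans (cong (_∸ h) deg-G≡h+deg-H) (m+n∸m≡n h (deg H v)))))) (≰⇒> t≰)

IsMinDegree-unique : ∀ {n} {G : Graph n} {a b} → IsMinDegree G a → IsMinDegree G b → a ≡ b
IsMinDegree-unique ((u , deg-u≡a) , a≤deg) ((v , deg-v≡b) , b≤deg) =
  ≤-antisym (≤-trans (a≤deg v) (≤-reflexive deg-v≡b)) (≤-trans (b≤deg u) (≤-reflexive deg-u≡a))

common-neighbour-bounds : ∀ {n} (G : Graph n) δ →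
  (3 ≤ δ × (∃[ c ] (IsMaxCommonNeighbours G c × c ≤ δ ∸ 2))) ⊎
  (4 ≤ δ × (∃[ c ] (IsMaxCommonNeighbours G c × c ≤ δ ∸ 1))) →
  ∃[ c ] ((∀ u v → u ≢ v → ∣ N G u ∩ N G v ∣ ≤ c) × 3 ≤ δ × c < δ × (δ ≡ 3 → c ≤ 1))
common-neighbour-bounds G δ (inj₁ (3≤δ , c , (_ , C≤c) , c≤δ∸2)) =
  c , C≤c , 3≤δ , ≤-<-trans c≤δ∸2 (∸-monoʳ-< (s≤s z≤n) (≤-trans (n≤1+n 2) 3≤δ)) , λ { refl → c≤δ∸2 }
common-neighbour-bounds G δ (inj₂ (4≤δ , c , (_ , C≤c) , c≤δ∸1)) =
  c , C≤c , ≤-trans (n≤1+n 3) 4≤δ , ≤-<-trans c≤δ∸1 (∸-monoʳ-< (s≤s z≤n) (≤-trans (s≤s z≤n) 4≤δ)) ,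
  λ { refl → ⊥-elim (1+n≰n 4≤δ) }

h≤⌊δ-1⌋/2⇒h<δ∸h : ∀ {δ h} → 1 ≤ δ → h ≤ (δ ∸ 1) / 2 → h < δ ∸ h × δ ∸ h + h ≡ δ
h≤⌊δ-1⌋/2⇒h<δ∸h {δ} {h} 1≤δ h≤ =
  +-cancelʳ-≤ h (suc h) (δ ∸ h) (≤-trans 2h+1≤δ (≤-reflexive (≡.sym δ∸h+h≡δ))) , δ∸h+h≡δ
  where
  open ≤-Reasoning
  2h+1≤δ : suc h + h ≤ δ
  2h+1≤δ = begin
    suc h + h                 ≡⟨ cong suc (trans (*-comm h 2) (cong (h +_) (+-identityʳ h))) ⟨
    suc (h * 2)               ≤⟨ s≤s (*-monoˡ-≤ 2 h≤) ⟩
    suc ((δ ∸ 1) / 2 * 2)     ≤⟨ s≤s (m/n*n≤m (δ ∸ 1) 2) ⟩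
    suc (δ ∸ 1)               ≡⟨ +-comm 1 (δ ∸ 1) ⟩
    δ ∸ 1 + 1                 ≡⟨ m∸n+n≡m 1≤δ ⟩
    δ                         ∎
  δ∸h+h≡δ : δ ∸ h + h ≡ δ
  δ∸h+h≡δ = m∸n+n≡m (≤-trans (m≤n+m h (suc h)) 2h+1≤δ)

corollary4p7 : ∀ {n} (G : Graph n) (δ : ℕ) → IsMinDegree G δ → MaximallyConnected G →
    ((3 ≤ δ × (∃[ c ] (IsMaxCommonNeighbours G c × c ≤ δ ∸ 2)))
      ⊎ (4 ≤ δ × (∃[ c ] (IsMaxCommonNeighbours G c × c ≤ δ ∸ 1)))) →
    ∀ (h : ℕ) → h ≤ (δ ∸ 1) / 2 → 2 * (δ ∸ h) + 3 ≤ n →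
    IsEdgeTolerableDiagnosability G h (δ ∸ h)
corollary4p7 G δ δ-min (κ , κ-min , κ-conn) hypotheses h h≤ 2t+3≤n
  with common-neighbour-bounds G δ hypotheses
... | c , C≤c , 3≤δ , c<δ , δ≡3⇒c≤1 =
  lower-bound G t+h≡δ (proj₂ δ-min) δ≤κ 3≤δ c<δ δ≡3⇒c≤1 C≤c h<t 2t+3≤n ,
  λ t′ tolerable → subst (λ d → t′ ≤ d ∸ h) deg-v≡δ
                      (upper-bound G (≤-trans h≤δ (≤-reflexive (≡.sym deg-v≡δ))) tolerable)
  where
  δ≤κ : ∀ S → DisconnectedOrTrivial G S → δ ≤ ∣ S ∣
  δ≤κ S disconnecting = subst (_≤ ∣ S ∣) (IsMinDegree-unique {G = G} κ-min δ-min) (proj₂ κ-conn S disconnecting)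
  h<t = proj₁ (h≤⌊δ-1⌋/2⇒h<δ∸h (≤-trans (s≤s z≤n) 3≤δ) h≤)
  t+h≡δ = proj₂ (h≤⌊δ-1⌋/2⇒h<δ∸h (≤-trans (s≤s z≤n) 3≤δ) h≤)
  h≤δ : h ≤ δ
  h≤δ = ≤-trans (m≤n+m h (δ ∸ h)) (≤-reflexive t+h≡δ)
  deg-v≡δ = proj₂ (proj₁ δ-min)
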